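{- Let $n>d\ge1$ be integers and let $B(n,d)$ be the bipartite graph with vertex set $\mathcal{L}^n_d\cup\mathcal{L}^n_{d-1}$, where $\mathcal{L}^n_j=\{x\subseteq[n]:|x|=j\}$, with $x,y$ adjacent iff $x\subsetneq y$. Let $A\subseteq\mathcal{L}^n_d$ and let $M$ be an induced matching in $B(n,d)$. Set $A'=N(A)\cap V(M)$ and $H=N(A)\setminus A'$, and suppose that every $x\in A\setminus V(M)$ has no neighbor in $V(M)$. Then \[ e(H,\mathcal{L}^n_d\setminus A)\ge\frac{d}{n-d}\left(|A|-\frac{|A|^2}{\binom{n-1}{d-1}}\right). \]
   Context: An induced matching is a set $M$ of pairwise disjoint edges such that for distinct $xy,uv\in M$ none of $xu,xv,yu,yv$ is an edge; $V(M)$ is the set of endpoints of edges of $M$. $e(X,Y)$ is the number of edges with one endpoint in $X$ and the other in $Y$. $N(A)$ is the set of vertices with a neighbor in $A$. -}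

module Defs where

open import Data.Nat using (ℕ; _∸_)
open import Data.Fin using (Fin)
open import Data.Fin.Subset using (Subset; ∣_∣; _⊂_)
open import Data.List using (List; length; lookup)
import Data.List.Membership.Propositional as LM
open import Data.Product using (_×_; ∃; proj₁; proj₂)
open import Data.Sum using (_⊎_)
open import Relation.Binary.PropositionalEquality using (_≡_; _≢_)
open import Relation.Nullary using (¬_)

Vertex : (n d : ℕ) → Subset n → Set
Vertex n d v = ∣ v ∣ ≡ d ⊎ ∣ v ∣ ≡ d ∸ 1

Adj : (n d : ℕ) → Subset n → Subset n → Set
Adj n d u v = Vertex n d u × Vertex n d v × (u ⊂ v ⊎ v ⊂ u)

IsInducedMatching : (n d : ℕ) → List (Subset n × Subset n) → Set
IsInducedMatching n d M =
  (∀ (i : Fin (length M)) → Adj n d (proj₁ (lookup M i)) (proj₂ (lookup M i))) ×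
  (∀ (i j : Fin (length M)) → i ≢ j →
     let x = proj₁ (lookup M i) ; y = proj₂ (lookup M i)
         u = proj₁ (lookup M j) ; v = proj₂ (lookup M j)
     in (x ≢ u × x ≢ v × y ≢ u × y ≢ v) ×
        (¬ Adj n d x u × ¬ Adj n d x v × ¬ Adj n d y u × ¬ Adj n d y v))

InVM : {n : ℕ} → List (Subset n × Subset n) → Subset n → Set
InVM M v = ∃ λ e → e LM.∈ M × (v ≡ proj₁ e ⊎ v ≡ proj₂ e)

InN : (n d : ℕ) → List (Subset n) → Subset n → Set
InN n d A v = Vertex n d v × ∃ λ a → a LM.∈ A × Adj n d v a

InH : (n d : ℕ) → List (Subset n) → List (Subset n × Subset n) → Subset n → Set
InH n d A M v = InN n d A v × ¬ InVM M v

EdgeHOut : (n d : ℕ) → List (Subset n) → List (Subset n × Subset n) → Subset n × Subset n → Set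
EdgeHOut n d A M p =
  InH n d A M (proj₁ p) × ∣ proj₂ p ∣ ≡ d × ¬ (proj₂ p LM.∈ A) × Adj n d (proj₁ p) (proj₂ p)

-- Let f = 1_A on the cube 2^[n] and D the down operator, so that D f h counts the edges from a
-- (d−1)-set h into A and D(1_{L_d} − f) h the edges from h to L_d ∖ A; the two add up to n − d + 1.
-- Charging each h with D f h > 0 to H if h ∉ V(M) and to V(M) otherwise, and using that (M being
-- induced) each x ∈ A lies above at most one vertex of V(M), gives
--   (n−d+1)·d·|A| − ‖D f‖² = Σ_h D f h·(n−d+1−D f h) ≤ (n−d)·(e(H, L_d ∖ A) + |A|).
-- Conversely the commutation relation D U − U D = n − 2|x| shows that ‖D g‖² ≤ (d−1)(n−d)‖g‖² for
-- every mean-zero g on level d; applied to g = N·f − |A|·1_{L_d} with N = C(n,d) it yields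
--   N‖D f‖² ≤ (d−1)(n−d)(N|A| − |A|²) + (n−d+1)·d·|A|².
-- Eliminating ‖D f‖² and using n·C(n−1,d−1) = d·N gives the inequality.

module Submission where

open import Data.Bool using (Bool; true; false; _∧_; _∨_; not)
import Data.Bool.Properties as Boolₚ
open import Data.Empty using (⊥-elim)
open import Data.Fin as Fin using (Fin)
open import Data.Fin.Subset using (Subset; ∣_∣; ⊥; _⊂_)
open import Data.Fin.Subset.Properties using (s⊂s; out⊂in; ⊆-reflexive)
open import Data.Integer as ℤ using (ℤ; +_; -[1+_]; +≤+; 0ℤ; 1ℤ; -1ℤ; _≤ᵇ_; _+_; _-_; _*_; -_; _≤_)
import Data.Integer.Properties as ℤₚ
open import Algebra.Properties.CommutativeSemigroup ℤₚ.+-commutativeSemigroup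
  using () renaming (interchange to +-interchange)
open import Algebra.Properties.CommutativeSemigroup ℤₚ.*-commutativeSemigroup
  using () renaming (x∙yz≈y∙xz to x*yz≡y*xz)
open import Data.Integer.Tactic.RingSolver using (solve-∀)
open import Data.List as List using (List; []; _∷_; length)
open import Data.List.Membership.Propositional using (_∈_; _∉_)
open import Data.List.Relation.Unary.All as All using (All)
open import Data.List.Relation.Unary.All.Properties using (All¬⇒¬Any)
open import Data.List.Relation.Unary.AllPairs using ([]; _∷_)
open import Data.List.Relation.Unary.Any using (here; there; index)
open import Data.List.Relation.Unary.Any.Properties using (lookup-index)
open import Data.List.Relation.Unary.Unique.Propositional using (Unique)
open import Data.Nat as ℕ using (ℕ; zero; suc; _≡ᵇ_)
open import Data.Nat.Combinatorics using (_C_; nCk+nC[k+1]≡[n+1]C[k+1]; nC1≡n)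
import Data.Nat.Properties as ℕₚ
open import Data.Nat.Tactic.RingSolver using () renaming (solve-∀ to ℕ-solve-∀)
open import Data.Product as Product using (_×_; _,_; ∃; proj₁; proj₂)
open import Data.Sum as Sum using (_⊎_; inj₁; inj₂)
open import Data.Vec using ([]; _∷_)
open import Function using (_∘_; id)
open import Function.Bundles using (_⇔_; Equivalence)
open import Relation.Binary.PropositionalEquality
open import Relation.Nullary using (¬_; yes; no)

open import Defs

Fun : ℕ → Set
Fun n = Subset n → ℤ

private variable
  n k d : ℕ
  f g : Fun n

infix 10 _⁰ _¹
_⁰ _¹ : Fun (suc n) → Fun n
(f ⁰) x = f (false ∷ x)
(f ¹) x = f (true ∷ x)

∑ : Fun n → ℤ
∑ {zero}  f = f []
∑ {suc n} f = ∑ (f ⁰) + ∑ (f ¹)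

∑-cong : (∀ x → f x ≡ g x) → ∑ f ≡ ∑ g
∑-cong {zero}  f≡g = f≡g []
∑-cong {suc n} f≡g = cong₂ _+_ (∑-cong (λ x → f≡g (false ∷ x))) (∑-cong (λ x → f≡g (true ∷ x)))

∑-+ : ∀ (f g : Fun n) → ∑ (λ x → f x + g x) ≡ ∑ f + ∑ g
∑-+ {zero}  f g = refl
∑-+ {suc n} f g = trans (cong₂ _+_ (∑-+ (f ⁰) (g ⁰)) (∑-+ (f ¹) (g ¹)))
                        (+-interchange (∑ (f ⁰)) (∑ (g ⁰)) (∑ (f ¹)) (∑ (g ¹)))

∑-*ˡ : ∀ c (f : Fun n) → ∑ (λ x → c * f x) ≡ c * ∑ f
∑-*ˡ {zero}  c f = refl
∑-*ˡ {suc n} c f = trans (cong₂ _+_ (∑-*ˡ c (f ⁰)) (∑-*ˡ c (f ¹))) (sym (ℤₚ.*-distribˡ-+ c _ _))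

∑-linear : ∀ a b (f g : Fun n) → ∑ (λ x → a * f x + b * g x) ≡ a * ∑ f + b * ∑ g
∑-linear a b f g = trans (∑-+ (λ x → a * f x) (λ x → b * g x)) (cong₂ _+_ (∑-*ˡ a f) (∑-*ˡ b g))

∑-≡0 : (∀ x → f x ≡ 0ℤ) → ∑ f ≡ 0ℤ
∑-≡0 {zero}  f≡0 = f≡0 []
∑-≡0 {suc n} f≡0 = cong₂ _+_ (∑-≡0 (λ x → f≡0 (false ∷ x))) (∑-≡0 (λ x → f≡0 (true ∷ x)))

∑-mono-≤ : (∀ x → f x ≤ g x) → ∑ f ≤ ∑ g
∑-mono-≤ {zero}  f≤g = f≤g []
∑-mono-≤ {suc n} f≤g = ℤₚ.+-mono-≤ (∑-mono-≤ (λ x → f≤g (false ∷ x))) (∑-mono-≤ (λ x → f≤g (true ∷ x)))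

∑-nonneg : (∀ x → 0ℤ ≤ f x) → 0ℤ ≤ ∑ f
∑-nonneg {zero}  0≤f = 0≤f []
∑-nonneg {suc n} 0≤f = ℤₚ.+-mono-≤ (∑-nonneg (λ x → 0≤f (false ∷ x))) (∑-nonneg (λ x → 0≤f (true ∷ x)))

⟨_,_⟩ : Fun n → Fun n → ℤ
⟨ f , g ⟩ = ∑ (λ x → f x * g x)

‖_‖² : Fun n → ℤ
‖ f ‖² = ⟨ f , f ⟩

square-nonneg : ∀ z → 0ℤ ≤ z * z
square-nonneg (+ zero)  = ℤₚ.≤-refl
square-nonneg (+ suc _) = +≤+ ℕ.z≤n
square-nonneg -[1+ _ ]  = +≤+ ℕ.z≤n

‖‖²-nonneg : ∀ (f : Fun n) → 0ℤ ≤ ‖ f ‖²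
‖‖²-nonneg f = ∑-nonneg (λ x → square-nonneg (f x))

term≤∑ : (∀ x → 0ℤ ≤ f x) → ∀ y → f y ≤ ∑ f
term≤∑ {zero}  0≤f []          = ℤₚ.≤-refl
term≤∑ {suc n} 0≤f (false ∷ y) =
  ℤₚ.≤-trans (ℤₚ.≤-reflexive (sym (ℤₚ.+-identityʳ _)))
             (ℤₚ.+-mono-≤ (term≤∑ (λ x → 0≤f (false ∷ x)) y) (∑-nonneg (λ x → 0≤f (true ∷ x))))
term≤∑ {suc n} 0≤f (true ∷ y)  =
  ℤₚ.≤-trans (ℤₚ.≤-reflexive (sym (ℤₚ.+-identityˡ _)))
             (ℤₚ.+-mono-≤ (∑-nonneg (λ x → 0≤f (false ∷ x))) (term≤∑ (λ x → 0≤f (true ∷ x)) y))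

‖‖²≡0⇒≡0 : ‖ f ‖² ≡ 0ℤ → ∀ x → f x ≡ 0ℤ
‖‖²≡0⇒≡0 {f = f} ‖f‖²≡0 x = Sum.[ id , id ]′ (ℤₚ.i*j≡0⇒i≡0∨j≡0 (f x) square≡0)
  where
  square≡0 : f x * f x ≡ 0ℤ
  square≡0 = ℤₚ.≤-antisym (subst (f x * f x ≤_) ‖f‖²≡0 (term≤∑ (λ y → square-nonneg (f y)) x))
                          (square-nonneg (f x))

norm²-lincomb : ∀ a b (f g : Fun n) →
  ‖ (λ x → a * f x + b * g x) ‖² ≡ (a * a) * ‖ f ‖² + (+ 2 * a * b) * ⟨ f , g ⟩ + (b * b) * ‖ g ‖²
norm²-lincomb a b f g = begin
  ∑ (λ x → (a * f x + b * g x) * (a * f x + b * g x))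
    ≡⟨ ∑-cong (λ x → expand a b (f x) (g x)) ⟩
  ∑ (λ x → ((a * a) * (f x * f x) + (+ 2 * a * b) * (f x * g x)) + (b * b) * (g x * g x))
    ≡⟨ ∑-+ (λ x → (a * a) * (f x * f x) + (+ 2 * a * b) * (f x * g x)) (λ x → (b * b) * (g x * g x)) ⟩
  ∑ (λ x → (a * a) * (f x * f x) + (+ 2 * a * b) * (f x * g x)) + ∑ (λ x → (b * b) * (g x * g x))
    ≡⟨ cong₂ _+_ (∑-linear (a * a) (+ 2 * a * b) (λ x → f x * f x) (λ x → f x * g x))
                 (∑-*ˡ (b * b) (λ x → g x * g x)) ⟩
  (a * a) * ‖ f ‖² + (+ 2 * a * b) * ⟨ f , g ⟩ + (b * b) * ‖ g ‖²
  ∎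
  where
  open ≡-Reasoning
  expand : ∀ a b u v → (a * u + b * v) * (a * u + b * v) ≡ (a * a) * (u * u) + (+ 2 * a * b) * (u * v) + (b * b) * (v * v)
  expand = solve-∀

-- (down f) h sums f over the sets covering h, and (up g) x sums g over the sets covered by x.
down : Fun n → Fun n
down {zero}  f []          = 0ℤ
down {suc n} f (false ∷ h) = f (true ∷ h) + down (f ⁰) h
down {suc n} f (true ∷ h)  = down (f ¹) h

up : Fun n → Fun n
up {zero}  g []          = 0ℤ
up {suc n} g (false ∷ x) = up (g ⁰) x
up {suc n} g (true ∷ x)  = g (false ∷ x) + up (g ¹) x

down-+ : ∀ (f g : Fun n) h → down (λ x → f x + g x) h ≡ down f h + down g h
down-+ {zero}  f g []          = refl
down-+ {suc n} f g (false ∷ h) =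
  trans (cong (_+_ (f (true ∷ h) + g (true ∷ h))) (down-+ (f ⁰) (g ⁰) h))
        (+-interchange (f (true ∷ h)) (g (true ∷ h)) (down (f ⁰) h) (down (g ⁰) h))
down-+ {suc n} f g (true ∷ h)  = down-+ (f ¹) (g ¹) h

down-*ˡ : ∀ c (f : Fun n) h → down (λ x → c * f x) h ≡ c * down f h
down-*ˡ {zero}  c f []          = sym (ℤₚ.*-zeroʳ c)
down-*ˡ {suc n} c f (false ∷ h) =
  trans (cong (_+_ (c * f (true ∷ h))) (down-*ˡ c (f ⁰) h)) (sym (ℤₚ.*-distribˡ-+ c _ _))
down-*ˡ {suc n} c f (true ∷ h)  = down-*ˡ c (f ¹) h

down-linear : ∀ a b (f g : Fun n) h → down (λ x → a * f x + b * g x) h ≡ a * down f h + b * down g h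
down-linear a b f g h =
  trans (down-+ (λ x → a * f x) (λ x → b * g x) h) (cong₂ _+_ (down-*ˡ a f h) (down-*ˡ b g h))

down-≡0 : (∀ x → f x ≡ 0ℤ) → ∀ h → down f h ≡ 0ℤ
down-≡0 {zero}  f≡0 []          = refl
down-≡0 {suc n} f≡0 (false ∷ h) = cong₂ _+_ (f≡0 (true ∷ h)) (down-≡0 (λ x → f≡0 (false ∷ x)) h)
down-≡0 {suc n} f≡0 (true ∷ h)  = down-≡0 (λ x → f≡0 (true ∷ x)) h

down-cong : (∀ x → f x ≡ g x) → ∀ h → down f h ≡ down g h
down-cong {zero}  f≡g []          = refl
down-cong {suc n} f≡g (false ∷ h) = cong₂ _+_ (f≡g (true ∷ h)) (down-cong (λ x → f≡g (false ∷ x)) h)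
down-cong {suc n} f≡g (true ∷ h)  = down-cong (λ x → f≡g (true ∷ x)) h

down-nonneg : (∀ x → 0ℤ ≤ f x) → ∀ h → 0ℤ ≤ down f h
down-nonneg {zero}  0≤f []          = ℤₚ.≤-refl
down-nonneg {suc n} 0≤f (false ∷ h) = ℤₚ.+-mono-≤ (0≤f (true ∷ h)) (down-nonneg (λ x → 0≤f (false ∷ x)) h)
down-nonneg {suc n} 0≤f (true ∷ h)  = down-nonneg (λ x → 0≤f (true ∷ x)) h

up-+ : ∀ (f g : Fun n) x → up (λ h → f h + g h) x ≡ up f x + up g x
up-+ {zero}  f g []          = refl
up-+ {suc n} f g (false ∷ x) = up-+ (f ⁰) (g ⁰) x
up-+ {suc n} f g (true ∷ x)  =
  trans (cong (_+_ (f (false ∷ x) + g (false ∷ x))) (up-+ (f ¹) (g ¹) x))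
        (+-interchange (f (false ∷ x)) (g (false ∷ x)) (up (f ¹) x) (up (g ¹) x))

down-up-adjoint : ∀ (f g : Fun n) → ⟨ down f , g ⟩ ≡ ⟨ f , up g ⟩
down-up-adjoint {zero}  f g = trans (ℤₚ.*-zeroˡ (g [])) (sym (ℤₚ.*-zeroʳ (f [])))
down-up-adjoint {suc n} f g = begin
  ∑ (λ x → (f (true ∷ x) + down (f ⁰) x) * g (false ∷ x)) + ⟨ down (f ¹) , g ¹ ⟩
    ≡⟨ cong (_+ ⟨ down (f ¹) , g ¹ ⟩)
            (trans (∑-cong (λ x → ℤₚ.*-distribʳ-+ (g (false ∷ x)) (f (true ∷ x)) (down (f ⁰) x)))
                   (∑-+ (λ x → f (true ∷ x) * g (false ∷ x)) (λ x → down (f ⁰) x * g (false ∷ x)))) ⟩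
  (c + ⟨ down (f ⁰) , g ⁰ ⟩) + ⟨ down (f ¹) , g ¹ ⟩
    ≡⟨ cong₂ (λ u v → (c + u) + v) (down-up-adjoint (f ⁰) (g ⁰)) (down-up-adjoint (f ¹) (g ¹)) ⟩
  (c + ⟨ f ⁰ , up (g ⁰) ⟩) + ⟨ f ¹ , up (g ¹) ⟩
    ≡⟨ shuffle c ⟨ f ⁰ , up (g ⁰) ⟩ ⟨ f ¹ , up (g ¹) ⟩ ⟩
  ⟨ f ⁰ , up (g ⁰) ⟩ + (c + ⟨ f ¹ , up (g ¹) ⟩)
    ≡⟨ cong (_+_ ⟨ f ⁰ , up (g ⁰) ⟩)
            (sym (trans (∑-cong (λ x → ℤₚ.*-distribˡ-+ (f (true ∷ x)) (g (false ∷ x)) (up (g ¹) x)))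
                        (∑-+ (λ x → f (true ∷ x) * g (false ∷ x)) (λ x → f (true ∷ x) * up (g ¹) x)))) ⟩
  ⟨ f ⁰ , up (g ⁰) ⟩ + ∑ (λ x → f (true ∷ x) * (g (false ∷ x) + up (g ¹) x))
  ∎
  where
  open ≡-Reasoning
  c : ℤ
  c = ∑ (λ x → f (true ∷ x) * g (false ∷ x))
  shuffle : ∀ a b e → (a + b) + e ≡ b + (a + e)
  shuffle = solve-∀

down-up-comm : ∀ (g : Fun n) x → down (up g) x ≡ up (down g) x + (+ n - + ∣ x ∣ - + ∣ x ∣) * g x
down-up-comm {zero}  g []          = solve (g [])
  where solve : ∀ z → 0ℤ ≡ 0ℤ + (0ℤ - 0ℤ - 0ℤ) * z
        solve = solve-∀
down-up-comm {suc n} g (false ∷ x) = begin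
  (g (false ∷ x) + up (g ¹) x) + down (up (g ⁰)) x
    ≡⟨ cong (_+_ (g (false ∷ x) + up (g ¹) x)) (down-up-comm (g ⁰) x) ⟩
  (g (false ∷ x) + up (g ¹) x) + (up (down (g ⁰)) x + (+ n - + ∣ x ∣ - + ∣ x ∣) * g (false ∷ x))
    ≡⟨ regroup (g (false ∷ x)) (up (g ¹) x) (up (down (g ⁰)) x) (+ n) (+ ∣ x ∣) ⟩
  (up (g ¹) x + up (down (g ⁰)) x) + (+ suc n - + ∣ x ∣ - + ∣ x ∣) * g (false ∷ x)
    ≡⟨ cong (_+ (+ suc n - + ∣ x ∣ - + ∣ x ∣) * g (false ∷ x)) (sym (up-+ (g ¹) (down (g ⁰)) x)) ⟩
  up (λ h → g (true ∷ h) + down (g ⁰) h) x + (+ suc n - + ∣ x ∣ - + ∣ x ∣) * g (false ∷ x)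
  ∎
  where
  open ≡-Reasoning
  regroup : ∀ a u v m s → (a + u) + (v + (m - s - s) * a) ≡ (u + v) + ((1ℤ + m) - s - s) * a
  regroup = solve-∀
down-up-comm {suc n} g (true ∷ x)  = begin
  down (λ h → g (false ∷ h) + up (g ¹) h) x
    ≡⟨ down-+ (g ⁰) (up (g ¹)) x ⟩
  down (g ⁰) x + down (up (g ¹)) x
    ≡⟨ cong (_+_ (down (g ⁰) x)) (down-up-comm (g ¹) x) ⟩
  down (g ⁰) x + (up (down (g ¹)) x + (+ n - + ∣ x ∣ - + ∣ x ∣) * g (true ∷ x))
    ≡⟨ regroup (g (true ∷ x)) (down (g ⁰) x) (up (down (g ¹)) x) (+ n) (+ ∣ x ∣) ⟩
  ((g (true ∷ x) + down (g ⁰) x) + up (down (g ¹)) x) + (+ suc n - + (suc ∣ x ∣) - + (suc ∣ x ∣)) * g (true ∷ x)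
  ∎
  where
  open ≡-Reasoning
  regroup : ∀ a v u m s → v + (u + (m - s - s) * a) ≡ ((a + v) + u) + ((1ℤ + m) - (1ℤ + s) - (1ℤ + s)) * a
  regroup = solve-∀

down-radial : ∀ (φ : ℕ → ℤ) (h : Subset n) → down (λ x → φ ∣ x ∣) h ≡ (+ n - + ∣ h ∣) * φ (suc ∣ h ∣)
down-radial {zero}  φ []          = solve (φ 1)
  where solve : ∀ z → 0ℤ ≡ (0ℤ - 0ℤ) * z
        solve = solve-∀
down-radial {suc n} φ (false ∷ h) =
  trans (cong (_+_ (φ (suc ∣ h ∣))) (down-radial φ h)) (regroup (φ (suc ∣ h ∣)) (+ n) (+ ∣ h ∣))
  where regroup : ∀ a m s → a + (m - s) * a ≡ ((1ℤ + m) - s) * a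
        regroup = solve-∀
down-radial {suc n} φ (true ∷ h)  =
  trans (down-radial (φ ∘ suc) h) (regroup (φ (suc (suc ∣ h ∣))) (+ n) (+ ∣ h ∣))
  where regroup : ∀ a m s → (m - s) * a ≡ ((1ℤ + m) - (1ℤ + s)) * a
        regroup = solve-∀

up-const : ∀ (x : Subset n) → up (λ _ → 1ℤ) x ≡ + ∣ x ∣
up-const {zero}  []          = refl
up-const {suc n} (false ∷ x) = up-const x
up-const {suc n} (true ∷ x)  = cong (_+_ 1ℤ) (up-const x)

OnLevel : ℕ → Fun n → Set
OnLevel d f = ∀ x → ∣ x ∣ ≢ d → f x ≡ 0ℤ

down-≡0-off-level : ∀ {n d} {f : Fun n} → OnLevel d f → ∀ h → suc ∣ h ∣ ≢ d → down f h ≡ 0ℤ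
down-≡0-off-level {zero}  _    []          _ = refl
down-≡0-off-level {suc n} f-on (false ∷ h) ≢d =
  cong₂ _+_ (f-on (true ∷ h) ≢d) (down-≡0-off-level (λ x → f-on (false ∷ x)) h ≢d)
down-≡0-off-level {suc n} {zero}    f-on (true ∷ h) _ = down-≡0 (λ x → f-on (true ∷ x) (λ ())) h
down-≡0-off-level {suc n} {suc d} f-on (true ∷ h) ≢d =
  down-≡0-off-level (λ x ≢d′ → f-on (true ∷ x) (≢d′ ∘ ℕₚ.suc-injective)) h (≢d ∘ cong suc)

down-onLevel : OnLevel (suc k) f → OnLevel k (down f)
down-onLevel f-on h ≢k = down-≡0-off-level f-on h (≢k ∘ ℕₚ.suc-injective)

⟨⟩-onLevel-radial : OnLevel d f → ∀ (φ : ℕ → ℤ) g → ⟨ f , (λ x → φ ∣ x ∣ * g x) ⟩ ≡ φ d * ⟨ f , g ⟩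
⟨⟩-onLevel-radial {d = d} {f = f} f-on φ g = trans (∑-cong pointwise) (∑-*ˡ (φ d) (λ x → f x * g x))
  where
  pointwise : ∀ x → f x * (φ ∣ x ∣ * g x) ≡ φ d * (f x * g x)
  pointwise x with ∣ x ∣ ℕ.≟ d
  ... | yes refl = x*yz≡y*xz (f x) (φ ∣ x ∣) (g x)
  ... | no ≢d rewrite f-on x ≢d =
    trans (ℤₚ.*-zeroˡ (φ ∣ x ∣ * g x)) (sym (trans (cong (φ d *_) (ℤₚ.*-zeroˡ (g x))) (ℤₚ.*-zeroʳ (φ d))))

∑-down : OnLevel d f → ∑ (down f) ≡ + d * ∑ f
∑-down {d = d} {f = f} f-on = begin
  ∑ (down f)                          ≡⟨ ∑-cong (λ x → sym (ℤₚ.*-identityʳ (down f x))) ⟩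
  ⟨ down f , (λ _ → 1ℤ) ⟩             ≡⟨ down-up-adjoint f (λ _ → 1ℤ) ⟩
  ⟨ f , up (λ _ → 1ℤ) ⟩               ≡⟨ ∑-cong (λ x → cong (f x *_) (trans (up-const x) (sym (ℤₚ.*-identityʳ _)))) ⟩
  ⟨ f , (λ x → + ∣ x ∣ * 1ℤ) ⟩        ≡⟨ ⟨⟩-onLevel-radial f-on +_ (λ _ → 1ℤ) ⟩
  + d * ⟨ f , (λ _ → 1ℤ) ⟩            ≡⟨ cong (+ d *_) (∑-cong (λ x → ℤₚ.*-identityʳ (f x))) ⟩
  + d * ∑ f                           ∎
  where open ≡-Reasoning

∑-onLevel₀ : OnLevel 0 g → ∑ g ≡ g ⊥
∑-onLevel₀ {zero}  g-on = refl
∑-onLevel₀ {suc n} {g = g} g-on =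
  trans (cong (_+_ (∑ (g ⁰))) (∑-≡0 (λ x → g-on (true ∷ x) (λ ()))))
        (trans (ℤₚ.+-identityʳ _) (∑-onLevel₀ (λ x → g-on (false ∷ x))))

up-norm-identity : ∀ {n d} {g : Fun n} → OnLevel d g → ‖ up g ‖² ≡ ‖ down g ‖² + (+ n - + d - + d) * ‖ g ‖²
up-norm-identity {n = n} {d = d} {g = g} g-on = begin
  ‖ up g ‖²
    ≡⟨ sym (down-up-adjoint (up g) g) ⟩
  ⟨ down (up g) , g ⟩
    ≡⟨ ∑-cong (λ x → trans (cong (_* g x) (down-up-comm g x))
                           (ℤₚ.*-distribʳ-+ (g x) (up (down g) x) (φ ∣ x ∣ * g x))) ⟩
  ∑ (λ x → up (down g) x * g x + (φ ∣ x ∣ * g x) * g x)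
    ≡⟨ ∑-+ (λ x → up (down g) x * g x) (λ x → (φ ∣ x ∣ * g x) * g x) ⟩
  ∑ (λ x → up (down g) x * g x) + ∑ (λ x → (φ ∣ x ∣ * g x) * g x)
    ≡⟨ cong₂ _+_ (∑-cong (λ x → ℤₚ.*-comm (up (down g) x) (g x)))
                 (∑-cong (λ x → ℤₚ.*-comm (φ ∣ x ∣ * g x) (g x))) ⟩
  ⟨ g , up (down g) ⟩ + ⟨ g , (λ x → φ ∣ x ∣ * g x) ⟩
    ≡⟨ cong₂ _+_ (sym (down-up-adjoint g (down g))) (⟨⟩-onLevel-radial g-on φ g) ⟩
  ‖ down g ‖² + φ d * ‖ g ‖²
  ∎
  where
  open ≡-Reasoning
  φ : ℕ → ℤ
  φ j = + n - + j - + j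

-- With F = ‖f‖², G = ⟨f,u⟩ and U = ‖u‖² the first hypothesis reads 0 ≤ ‖t f − u‖².
square-expansion-bound : ∀ t {F G U : ℤ} →
  0ℤ ≤ (+ t * + t) * F + (+ 2 * + t * -1ℤ) * G + (-1ℤ * -1ℤ) * U →
  U ≤ + t * G → (t ≡ 0 → G ≡ 0ℤ) → G ≤ + t * F
square-expansion-bound zero    _   _ t≡0⇒G≡0 = ℤₚ.≤-reflexive (t≡0⇒G≡0 refl)
square-expansion-bound (suc t) {F} {G} {U} 0≤expansion U≤tG _ =
  ℤₚ.0≤i-j⇒j≤i (ℤₚ.*-cancelˡ-≤-pos 0ℤ (+ suc t * F - G) (+ suc t) 0≤t[tF-G])
  where
  regroup : ∀ t F G U → (t * t) * F + (+ 2 * t * -1ℤ) * G + (-1ℤ * -1ℤ) * U + (t * G - U) ≡ t * (t * F - G)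
  regroup = solve-∀
  0≤t[tF-G] : + suc t * 0ℤ ≤ + suc t * (+ suc t * F - G)
  0≤t[tF-G] = subst₂ _≤_ (sym (ℤₚ.*-zeroʳ (+ suc t))) (regroup (+ suc t) F G U)
                (ℤₚ.+-mono-≤ 0≤expansion (ℤₚ.i≤j⇒0≤j-i U≤tG))

+n-+d≡+[n∸d] : d ℕ.≤ n → + n - + d ≡ + (n ℕ.∸ d)
+n-+d≡+[n∸d] {d} {n} d≤n = trans (ℤₚ.m-n≡m⊖n n d) (ℤₚ.⊖-≥ d≤n)

‖down‖²-level₁ : OnLevel 1 f → ∑ f ≡ 0ℤ → ‖ down f ‖² ≡ 0ℤ
‖down‖²-level₁ {f = f} f-on ∑f≡0 = begin
  ‖ down f ‖²            ≡⟨ ∑-onLevel₀ (λ x ≢0 → cong (_* down f x) (df-on x ≢0)) ⟩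
  down f ⊥ * down f ⊥    ≡⟨ cong (λ z → z * z) (trans (sym (∑-onLevel₀ df-on)) ∑df≡0) ⟩
  0ℤ                     ∎
  where
  open ≡-Reasoning
  df-on : OnLevel 0 (down f)
  df-on = down-onLevel f-on
  ∑df≡0 : ∑ (down f) ≡ 0ℤ
  ∑df≡0 = trans (∑-down f-on) (cong (1ℤ *_) ∑f≡0)

down-norm-bound : ∀ {n} {f : Fun n} k → suc k ℕ.≤ n → OnLevel (suc k) f → ∑ f ≡ 0ℤ →
  ‖ down f ‖² ≤ (+ k * (+ n - + suc k)) * ‖ f ‖²
down-norm-bound zero _ f-on ∑f≡0 = ℤₚ.≤-reflexive (‖down‖²-level₁ f-on ∑f≡0)
down-norm-bound {n = n} {f = f} (suc k) k+2≤n f-on ∑f≡0 =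
  subst (λ c → G ≤ c * F) (sym t≡) (square-expansion-bound t 0≤‖tf-udf‖² U≤tG t≡0⇒G≡0)
  where
  df : Fun n
  df = down f
  F G U : ℤ
  F = ‖ f ‖²
  G = ‖ df ‖²
  U = ‖ up df ‖²
  t : ℕ
  t = suc k ℕ.* (n ℕ.∸ suc (suc k))
  t≡ : + suc k * (+ n - + suc (suc k)) ≡ + t
  t≡ = trans (cong (+ suc k *_) (+n-+d≡+[n∸d] k+2≤n)) (sym (ℤₚ.pos-* (suc k) _))
  df-on : OnLevel (suc k) df
  df-on = down-onLevel f-on
  ∑df≡0 : ∑ df ≡ 0ℤ
  ∑df≡0 = trans (∑-down f-on) (trans (cong (+ suc (suc k) *_) ∑f≡0) (ℤₚ.*-zeroʳ (+ suc (suc k))))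
  regroup : ∀ K N G → K * (N - (1ℤ + K)) * G + (N - (1ℤ + K) - (1ℤ + K)) * G ≡ (1ℤ + K) * (N - (1ℤ + (1ℤ + K))) * G
  regroup = solve-∀
  U≤tG : U ≤ + t * G
  U≤tG = subst (U ≤_) (trans (regroup (+ k) (+ n) G) (cong (_* G) t≡))
           (subst (_≤ (+ k * (+ n - + suc k)) * G + φ * G) (sym (up-norm-identity df-on))
             (ℤₚ.+-monoˡ-≤ (φ * G) (down-norm-bound k (ℕₚ.<⇒≤ k+2≤n) df-on ∑df≡0)))
    where φ : ℤ
          φ = + n - + suc k - + suc k
  G≡⟨f,udf⟩ : G ≡ ⟨ f , up df ⟩
  G≡⟨f,udf⟩ = down-up-adjoint f df
  0≤‖tf-udf‖² : 0ℤ ≤ (+ t * + t) * F + (+ 2 * + t * -1ℤ) * G + (-1ℤ * -1ℤ) * U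
  0≤‖tf-udf‖² = subst (0ℤ ≤_)
    (trans (norm²-lincomb (+ t) -1ℤ f (up df))
           (cong (λ z → (+ t * + t) * F + (+ 2 * + t * -1ℤ) * z + (-1ℤ * -1ℤ) * U) (sym G≡⟨f,udf⟩)))
    (‖‖²-nonneg (λ x → + t * f x + -1ℤ * up df x))
  t≡0⇒G≡0 : t ≡ 0 → G ≡ 0ℤ
  t≡0⇒G≡0 t≡0 = trans G≡⟨f,udf⟩ (∑-≡0 (λ x → trans (cong (f x *_) (udf≡0 x)) (ℤₚ.*-zeroʳ (f x))))
    where
    udf≡0 : ∀ x → up df x ≡ 0ℤ
    udf≡0 = ‖‖²≡0⇒≡0 (ℤₚ.≤-antisym (subst (λ z → U ≤ + z * G) t≡0 U≤tG) (‖‖²-nonneg (up df)))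

𝟙 : Bool → ℤ
𝟙 true  = 1ℤ
𝟙 false = 0ℤ

-- Boolean _≡ᵇ_ so that level (suc d) (true ∷ x) reduces to level d x.
level : ℕ → Fun n
level d x = 𝟙 (∣ x ∣ ≡ᵇ d)

𝟙[d≡ᵇd]≡1 : ∀ d → 𝟙 (d ≡ᵇ d) ≡ 1ℤ
𝟙[d≡ᵇd]≡1 zero    = refl
𝟙[d≡ᵇd]≡1 (suc d) = 𝟙[d≡ᵇd]≡1 d

𝟙[j≡ᵇd]≡0 : ∀ {j d} → j ≢ d → 𝟙 (j ≡ᵇ d) ≡ 0ℤ
𝟙[j≡ᵇd]≡0 {zero}  {zero}  j≢d = ⊥-elim (j≢d refl)
𝟙[j≡ᵇd]≡0 {zero}  {suc d} _   = refl
𝟙[j≡ᵇd]≡0 {suc j} {zero}  _   = refl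
𝟙[j≡ᵇd]≡0 {suc j} {suc d} j≢d = 𝟙[j≡ᵇd]≡0 (j≢d ∘ cong suc)

level-onLevel : ∀ d → OnLevel d (level {n} d)
level-onLevel d x = 𝟙[j≡ᵇd]≡0

⟨⟩-level : OnLevel d f → ⟨ f , level d ⟩ ≡ ∑ f
⟨⟩-level {d = d} {f = f} f-on = begin
  ⟨ f , level d ⟩                               ≡⟨ ∑-cong (λ x → cong (f x *_) (sym (ℤₚ.*-identityʳ _))) ⟩
  ⟨ f , (λ x → 𝟙 (∣ x ∣ ≡ᵇ d) * 1ℤ) ⟩           ≡⟨ ⟨⟩-onLevel-radial f-on (λ j → 𝟙 (j ≡ᵇ d)) (λ _ → 1ℤ) ⟩
  𝟙 (d ≡ᵇ d) * ⟨ f , (λ _ → 1ℤ) ⟩               ≡⟨ cong₂ _*_ (𝟙[d≡ᵇd]≡1 d) (∑-cong (λ x → ℤₚ.*-identityʳ (f x))) ⟩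
  1ℤ * ∑ f                                      ≡⟨ ℤₚ.*-identityˡ (∑ f) ⟩
  ∑ f                                           ∎
  where open ≡-Reasoning

⟨down,down-level⟩ : ∀ {n k} {f : Fun n} → OnLevel (suc k) f →
  ⟨ down f , down (level (suc k)) ⟩ ≡ (+ n - + k) * (+ suc k * ∑ f)
⟨down,down-level⟩ {n} {k} {f} f-on = begin
  ⟨ down f , down (level (suc k)) ⟩
    ≡⟨ ∑-cong (λ h → cong (down f h *_) (trans (down-radial (λ j → 𝟙 (j ≡ᵇ suc k)) h) (sym (ℤₚ.*-identityʳ _)))) ⟩
  ⟨ down f , (λ h → φ ∣ h ∣ * 1ℤ) ⟩
    ≡⟨ ⟨⟩-onLevel-radial (down-onLevel f-on) φ (λ _ → 1ℤ) ⟩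
  φ k * ⟨ down f , (λ _ → 1ℤ) ⟩
    ≡⟨ cong₂ _*_ (trans (cong ((+ n - + k) *_) (𝟙[d≡ᵇd]≡1 k)) (ℤₚ.*-identityʳ (+ n - + k)))
                 (trans (∑-cong (λ h → ℤₚ.*-identityʳ (down f h))) (∑-down f-on)) ⟩
  (+ n - + k) * (+ suc k * ∑ f)
  ∎
  where
  open ≡-Reasoning
  φ : ℕ → ℤ
  φ j = (+ n - + j) * 𝟙 (j ≡ᵇ k)

∑-level : ∀ n d → ∑ (level {n} d) ≡ + (n C d)
∑-level zero    zero    = refl
∑-level zero    (suc d) = refl
∑-level (suc n) zero    =
  trans (cong (_+_ (∑ (level {n} 0))) (∑-≡0 {f = level {suc n} 0 ¹} (λ _ → refl)))
        (trans (ℤₚ.+-identityʳ _) (∑-level n 0))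
∑-level (suc n) (suc d) = begin
  ∑ (level {n} (suc d)) + ∑ (level {n} d) ≡⟨ cong₂ _+_ (∑-level n (suc d)) (∑-level n d) ⟩
  + (n C suc d) + + (n C d)                ≡⟨ ℤₚ.pos-+ (n C suc d) (n C d) ⟨
  + (n C suc d ℕ.+ n C d)                  ≡⟨ cong +_ (ℕₚ.+-comm (n C suc d) (n C d)) ⟩
  + (n C d ℕ.+ n C suc d)                  ≡⟨ cong +_ (nCk+nC[k+1]≡[n+1]C[k+1] n d) ⟩
  + (suc n C suc d)                        ∎
  where open ≡-Reasoning

0<nCk : k ℕ.≤ n → 0 ℕ.< n C k
0<nCk {zero}  {n}     _         = ℕ.s≤s ℕ.z≤n
0<nCk {suc k} {suc n} (ℕ.s≤s k≤n) =
  subst (0 ℕ.<_) (nCk+nC[k+1]≡[n+1]C[k+1] n k) (ℕₚ.≤-trans (0<nCk k≤n) (ℕₚ.m≤m+n _ _))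

[1+k]*[1+n]C[1+k]≡[1+n]*nCk : ∀ n k → suc k ℕ.* (suc n C suc k) ≡ suc n ℕ.* (n C k)
[1+k]*[1+n]C[1+k]≡[1+n]*nCk zero    zero    = refl
[1+k]*[1+n]C[1+k]≡[1+n]*nCk zero    (suc k) = ℕₚ.*-zeroʳ (suc (suc k))
[1+k]*[1+n]C[1+k]≡[1+n]*nCk (suc n) zero    =
  trans (ℕₚ.+-identityʳ _) (trans (nC1≡n (suc (suc n))) (sym (ℕₚ.*-identityʳ (suc (suc n)))))
[1+k]*[1+n]C[1+k]≡[1+n]*nCk (suc n) (suc k) = begin
  suc (suc k) ℕ.* (suc (suc n) C suc (suc k))
    ≡⟨ cong (suc (suc k) ℕ.*_) (nCk+nC[k+1]≡[n+1]C[k+1] (suc n) (suc k)) ⟨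
  suc (suc k) ℕ.* (a ℕ.+ b)                                   ≡⟨ distrib k a b ⟩
  suc k ℕ.* a ℕ.+ a ℕ.+ suc (suc k) ℕ.* b                     ≡⟨ cong₂ (λ u v → u ℕ.+ a ℕ.+ v)
                                                                   ([1+k]*[1+n]C[1+k]≡[1+n]*nCk n k)
                                                                   ([1+k]*[1+n]C[1+k]≡[1+n]*nCk n (suc k)) ⟩
  suc n ℕ.* (n C k) ℕ.+ a ℕ.+ suc n ℕ.* (n C suc k)           ≡⟨ collect (suc n) (n C k) a (n C suc k) ⟩
  suc n ℕ.* (n C k ℕ.+ n C suc k) ℕ.+ a                       ≡⟨ cong (λ z → suc n ℕ.* z ℕ.+ a) (nCk+nC[k+1]≡[n+1]C[k+1] n k) ⟩
  suc n ℕ.* a ℕ.+ a                                           ≡⟨ ℕₚ.+-comm (suc n ℕ.* a) a ⟩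
  suc (suc n) ℕ.* a                                           ∎
  where
  open ≡-Reasoning
  a b : ℕ
  a = suc n C suc k
  b = suc n C suc (suc k)
  distrib : ∀ j a b → suc (suc j) ℕ.* (a ℕ.+ b) ≡ suc j ℕ.* a ℕ.+ a ℕ.+ suc (suc j) ℕ.* b
  distrib = ℕ-solve-∀
  collect : ∀ m x a y → m ℕ.* x ℕ.+ a ℕ.+ m ℕ.* y ≡ m ℕ.* (x ℕ.+ y) ℕ.+ a
  collect = ℕ-solve-∀

-- N·f minus its mean on the level, N = |level (suc k)|; scaling by N avoids division.
centre : ∀ {n} k → Fun n → Fun n
centre {n} k f x = + (n C suc k) * f x + (- ∑ f) * level (suc k) x

centre-onLevel : ∀ {n k} {f : Fun n} → OnLevel (suc k) f → OnLevel (suc k) (centre k f)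
centre-onLevel {n} {k} {f} f-on x ≢d =
  trans (cong₂ (λ u v → N * u + (- ∑ f) * v) (f-on x ≢d) (level-onLevel (suc k) x ≢d)) (solve N (∑ f))
  where N : ℤ
        N = + (n C suc k)
        solve : ∀ N a → N * 0ℤ + (- a) * 0ℤ ≡ 0ℤ
        solve = solve-∀

∑-centre : ∀ {n} k (f : Fun n) → ∑ (centre k f) ≡ 0ℤ
∑-centre {n} k f =
  trans (∑-linear N (- ∑ f) f (level (suc k)))
        (trans (cong (λ z → N * ∑ f + (- ∑ f) * z) (∑-level n (suc k))) (solve N (∑ f)))
  where N : ℤ
        N = + (n C suc k)
        solve : ∀ N a → N * a + (- a) * N ≡ 0ℤ
        solve = solve-∀

‖centre‖² : ∀ {n} k {f : Fun n} → OnLevel (suc k) f → let N = + (n C suc k); a = ∑ f in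
  ‖ centre k f ‖² ≡ (N * N) * ‖ f ‖² + (+ 2 * N * - a) * a + (- a * - a) * N
‖centre‖² {n} k {f} f-on =
  trans (norm²-lincomb (+ (n C suc k)) (- ∑ f) f (level (suc k)))
        (cong₂ (λ u v → (N * N) * ‖ f ‖² + (+ 2 * N * - ∑ f) * u + (- ∑ f * - ∑ f) * v)
               (⟨⟩-level f-on) (trans (⟨⟩-level (level-onLevel {n} (suc k))) (∑-level n (suc k))))
  where N : ℤ
        N = + (n C suc k)

‖down-centre‖² : ∀ {n} k {f : Fun n} → OnLevel (suc k) f → let N = + (n C suc k); a = ∑ f in
  ‖ down (centre k f) ‖² ≡ (N * N) * ‖ down f ‖² + (+ 2 * N * - a) * ((+ n - + k) * (+ suc k * a))
                           + (- a * - a) * ((+ n - + k) * (+ suc k * N))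
‖down-centre‖² {n} k {f} f-on = begin
  ‖ down (centre k f) ‖²
    ≡⟨ ∑-cong (λ h → cong₂ _*_ (down-linear N (- ∑ f) f l h) (down-linear N (- ∑ f) f l h)) ⟩
  ‖ (λ h → N * down f h + (- ∑ f) * down l h) ‖²
    ≡⟨ norm²-lincomb N (- ∑ f) (down f) (down l) ⟩
  (N * N) * ‖ down f ‖² + (+ 2 * N * - ∑ f) * ⟨ down f , down l ⟩ + (- ∑ f * - ∑ f) * ‖ down l ‖²
    ≡⟨ cong₂ (λ u v → (N * N) * ‖ down f ‖² + (+ 2 * N * - ∑ f) * u + (- ∑ f * - ∑ f) * v)
             (⟨down,down-level⟩ f-on)
             (trans (⟨down,down-level⟩ (level-onLevel {n} (suc k)))
                    (cong (λ z → (+ n - + k) * (+ suc k * z)) (∑-level n (suc k)))) ⟩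
  (N * N) * ‖ down f ‖² + (+ 2 * N * - ∑ f) * ((+ n - + k) * (+ suc k * ∑ f))
    + (- ∑ f * - ∑ f) * ((+ n - + k) * (+ suc k * N))
  ∎
  where
  open ≡-Reasoning
  N : ℤ
  N = + (n C suc k)
  l : Fun n
  l = level (suc k)

level-variance-bound : ∀ {n} {f : Fun n} k → suc k ℕ.≤ n → OnLevel (suc k) f →
  let N = + (n C suc k); a = ∑ f in
  N * ‖ down f ‖² ≤ (+ k * (+ n - + suc k)) * (N * ‖ f ‖² - a * a) + ((+ n - + k) * + suc k) * (a * a)
level-variance-bound {n} {f} k k<n f-on =
  ℤₚ.*-cancelˡ-≤-pos _ _ N {{ℤ.positive (ℤ.+<+ (0<nCk k<n))}}
    (subst₂ _≤_ (regroupˡ N (‖ down f ‖²) a (+ n - + k) (+ suc k)) (regroupʳ N (‖ f ‖²) a λ₀ (+ n - + k) (+ suc k))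
      (ℤₚ.+-monoˡ-≤ (N * ((+ n - + k) * + suc k * (a * a)))
        (subst₂ _≤_ (‖down-centre‖² k f-on) (cong (λ₀ *_) (‖centre‖² k f-on))
                    (down-norm-bound k k<n (centre-onLevel f-on) (∑-centre k f)))))
  where
  N a λ₀ : ℤ
  N = + (n C suc k)
  a = ∑ f
  λ₀ = + k * (+ n - + suc k)
  regroupˡ : ∀ N Q a K d → (N * N) * Q + (+ 2 * N * - a) * (K * (d * a)) + (- a * - a) * (K * (d * N))
                           + N * (K * d * (a * a)) ≡ N * (N * Q)
  regroupˡ = solve-∀
  regroupʳ : ∀ N F a λ₀ K d → λ₀ * ((N * N) * F + (+ 2 * N * - a) * a + (- a * - a) * N) + N * (K * d * (a * a))
                              ≡ N * (λ₀ * (N * F - a * a) + (K * d) * (a * a))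
  regroupʳ = solve-∀

𝟙-nonneg : ∀ b → 0ℤ ≤ 𝟙 b
𝟙-nonneg true  = +≤+ ℕ.z≤n
𝟙-nonneg false = +≤+ ℕ.z≤n

𝟙-∧ : ∀ b c → 𝟙 (b ∧ c) ≡ 𝟙 b * 𝟙 c
𝟙-∧ true  c = sym (ℤₚ.*-identityˡ (𝟙 c))
𝟙-∧ false c = refl

𝟙-mono : ∀ {b c} → (b ≡ true → c ≡ true) → 𝟙 b ≤ 𝟙 c
𝟙-mono {false} {c}    _   = 𝟙-nonneg c
𝟙-mono {true}  {true} _   = ℤₚ.≤-refl
𝟙-mono {true}  {false} b⇒c with () ← b⇒c refl

𝟙*≢0 : ∀ b z → 𝟙 b * z ≢ 0ℤ → b ≡ true × z ≢ 0ℤ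
𝟙*≢0 true  z ≢0 = refl , ≢0 ∘ trans (ℤₚ.*-identityˡ z)
𝟙*≢0 false z ≢0 = ⊥-elim (≢0 refl)

𝟙≢0 : ∀ {b} → 𝟙 b ≢ 0ℤ → b ≡ true
𝟙≢0 {true}  _   = refl
𝟙≢0 {false} ≢0 = ⊥-elim (≢0 refl)

1≤ᵇ⇒≢0 : ∀ {z} → (1ℤ ≤ᵇ z) ≡ true → z ≢ 0ℤ
1≤ᵇ⇒≢0 {+ zero}   ()
1≤ᵇ⇒≢0 {+ suc _}  _ ()
1≤ᵇ⇒≢0 { -[1+ _ ]} ()

not≡true : ∀ {b} → not b ≡ true → b ≡ false
not≡true {false} _ = refl

infix 4 _==_
_==_ : Subset n → Subset n → Bool
[]          == []          = true
(false ∷ x) == (false ∷ y) = x == y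
(true ∷ x)  == (true ∷ y)  = x == y
(false ∷ x) == (true ∷ y)  = false
(true ∷ x)  == (false ∷ y) = false

==⇒≡ : ∀ {x y : Subset n} → (x == y) ≡ true → x ≡ y
==⇒≡ {x = []}          {[]}        _  = refl
==⇒≡ {x = false ∷ x}   {false ∷ y} eq = cong (false ∷_) (==⇒≡ eq)
==⇒≡ {x = true ∷ x}    {true ∷ y}  eq = cong (true ∷_) (==⇒≡ eq)

==-refl : ∀ (x : Subset n) → (x == x) ≡ true
==-refl []          = refl
==-refl (false ∷ x) = ==-refl x
==-refl (true ∷ x)  = ==-refl x

==-sym : ∀ (x y : Subset n) → (x == y) ≡ (y == x)
==-sym []          []          = refl
==-sym (false ∷ x) (false ∷ y) = ==-sym x y
==-sym (true ∷ x)  (true ∷ y)  = ==-sym x y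
==-sym (false ∷ x) (true ∷ y)  = refl
==-sym (true ∷ x)  (false ∷ y) = refl

∑-point : ∀ (h : Subset n) (F : Fun n) → ∑ (λ x → 𝟙 (h == x) * F x) ≡ F h
∑-point []          F = ℤₚ.*-identityˡ (F [])
∑-point (false ∷ h) F =
  trans (cong₂ _+_ (∑-point h (F ⁰)) (∑-≡0 (λ x → ℤₚ.*-zeroˡ (F (true ∷ x))))) (ℤₚ.+-identityʳ _)
∑-point (true ∷ h)  F =
  trans (cong₂ _+_ (∑-≡0 (λ x → ℤₚ.*-zeroˡ (F (false ∷ x)))) (∑-point h (F ¹))) (ℤₚ.+-identityˡ _)

∑-point′ : ∀ (h : Subset n) (F : Fun n) → ∑ (λ x → 𝟙 (x == h) * F x) ≡ F h
∑-point′ h F = trans (∑-cong (λ x → cong (λ b → 𝟙 b * F x) (==-sym x h))) (∑-point h F)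

∑-𝟙== : ∀ (h : Subset n) → ∑ (λ x → 𝟙 (x == h)) ≡ 1ℤ
∑-𝟙== h = trans (∑-cong (λ x → sym (ℤₚ.*-identityʳ (𝟙 (x == h))))) (∑-point′ h (λ _ → 1ℤ))

∑-witness : ∀ (F : Fun n) → ∑ F ≢ 0ℤ → ∃ λ x → F x ≢ 0ℤ
∑-witness {zero}  F ∑F≢0 = [] , ∑F≢0
∑-witness {suc n} F ∑F≢0 with ∑ (F ⁰) ℤ.≟ 0ℤ
... | no  ∑F⁰≢0 = Product.map (false ∷_) id (∑-witness (F ⁰) ∑F⁰≢0)
... | yes ∑F⁰≡0 = Product.map (true ∷_) id (∑-witness (F ¹) (∑F≢0 ∘ cong₂ _+_ ∑F⁰≡0))

∑-𝟙-≤1 : ∀ (p : Subset n → Bool) → (∀ h h′ → p h ≡ true → p h′ ≡ true → h ≡ h′) →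
  ∑ (𝟙 ∘ p) ≤ 1ℤ
∑-𝟙-≤1 p unique with ∑ (𝟙 ∘ p) ℤ.≟ 0ℤ
... | yes ∑≡0 = subst (_≤ 1ℤ) (sym ∑≡0) (+≤+ ℕ.z≤n)
... | no  ∑≢0 with ∑-witness (𝟙 ∘ p) ∑≢0
...   | h₀ , 𝟙ph₀≢0 = ℤₚ.≤-trans (∑-mono-≤ (λ h → 𝟙-mono (≤point h))) (ℤₚ.≤-reflexive (∑-𝟙== h₀))
  where
  ph₀ : p h₀ ≡ true
  ph₀ = 𝟙≢0 𝟙ph₀≢0
  ≤point : ∀ h → p h ≡ true → (h == h₀) ≡ true
  ≤point h ph = subst (λ h′ → (h′ == h₀) ≡ true) (sym (unique h h₀ ph ph₀)) (==-refl h₀)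

infix 4 _⋖_
_⋖_ : Subset n → Subset n → Bool
[]          ⋖ []          = false
(false ∷ h) ⋖ (false ∷ x) = h ⋖ x
(false ∷ h) ⋖ (true ∷ x)  = h == x
(true ∷ h)  ⋖ (true ∷ x)  = h ⋖ x
(true ∷ h)  ⋖ (false ∷ x) = false

⋖⇒∣∣ : ∀ {h x : Subset n} → (h ⋖ x) ≡ true → ∣ x ∣ ≡ suc ∣ h ∣
⋖⇒∣∣ {h = []}        {[]}        ()
⋖⇒∣∣ {h = false ∷ h} {false ∷ x} h⋖x  = ⋖⇒∣∣ {h = h} {x} h⋖x
⋖⇒∣∣ {h = false ∷ h} {true ∷ x}  h==x = cong (suc ∘ ∣_∣) (sym (==⇒≡ {x = h} {x} h==x))
⋖⇒∣∣ {h = true ∷ h}  {true ∷ x}  h⋖x  = cong suc (⋖⇒∣∣ {h = h} {x} h⋖x)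

⋖⇒⊂ : ∀ {h x : Subset n} → (h ⋖ x) ≡ true → h ⊂ x
⋖⇒⊂ {h = []}        {[]}        ()
⋖⇒⊂ {h = false ∷ h} {false ∷ x} h⋖x  = s⊂s (⋖⇒⊂ {h = h} {x} h⋖x)
⋖⇒⊂ {h = false ∷ h} {true ∷ x}  h==x = out⊂in (⊆-reflexive (==⇒≡ {x = h} {x} h==x))
⋖⇒⊂ {h = true ∷ h}  {true ∷ x}  h⋖x  = s⊂s (⋖⇒⊂ {h = h} {x} h⋖x)

down-as-sum : ∀ (f : Fun n) h → down f h ≡ ∑ (λ x → 𝟙 (h ⋖ x) * f x)
down-as-sum {zero}  f []          = sym (ℤₚ.*-zeroˡ (f []))
down-as-sum {suc n} f (false ∷ h) =
  trans (ℤₚ.+-comm (f (true ∷ h)) (down (f ⁰) h))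
        (cong₂ _+_ (down-as-sum (f ⁰) h) (sym (∑-point h (f ¹))))
down-as-sum {suc n} f (true ∷ h)  =
  trans (down-as-sum (f ¹) h)
        (trans (sym (ℤₚ.+-identityˡ _))
               (cong (_+ ∑ (λ x → 𝟙 (h ⋖ x) * f (true ∷ x))) (sym (∑-≡0 (λ x → ℤₚ.*-zeroˡ (f (false ∷ x)))))))

up-as-sum : ∀ (g : Fun n) x → up g x ≡ ∑ (λ h → 𝟙 (h ⋖ x) * g h)
up-as-sum {zero}  g []          = sym (ℤₚ.*-zeroˡ (g []))
up-as-sum {suc n} g (false ∷ x) =
  trans (up-as-sum (g ⁰) x)
        (trans (sym (ℤₚ.+-identityʳ _))
               (cong (_+_ (∑ (λ h → 𝟙 (h ⋖ x) * g (false ∷ h)))) (sym (∑-≡0 (λ h → ℤₚ.*-zeroˡ (g (true ∷ h)))))))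
up-as-sum {suc n} g (true ∷ x)  =
  cong₂ _+_ (sym (∑-point′ x (g ⁰))) (up-as-sum (g ¹) x)

module BoolMembership {X : Set} (_≈ᵇ_ : X → X → Bool)
  (≈ᵇ⇒≡ : ∀ {x y} → (x ≈ᵇ y) ≡ true → x ≡ y) (≈ᵇ-refl : ∀ x → (x ≈ᵇ x) ≡ true) where

  infix 4 _∈ᵇ_
  _∈ᵇ_ : X → List X → Bool
  x ∈ᵇ []      = false
  x ∈ᵇ (y ∷ L) = (x ≈ᵇ y) ∨ (x ∈ᵇ L)

  ∈ᵇ⇒∈ : ∀ {x} L → (x ∈ᵇ L) ≡ true → x ∈ L
  ∈ᵇ⇒∈ {x} (y ∷ L) x∈ᵇL with x ≈ᵇ y in x≈y
  ... | true  = here (≈ᵇ⇒≡ x≈y)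
  ... | false = there (∈ᵇ⇒∈ L x∈ᵇL)

  ∈⇒∈ᵇ : ∀ {x L} → x ∈ L → (x ∈ᵇ L) ≡ true
  ∈⇒∈ᵇ {x} (here refl) rewrite ≈ᵇ-refl x = refl
  ∈⇒∈ᵇ {x} {y ∷ _} (there x∈L) rewrite ∈⇒∈ᵇ x∈L = Boolₚ.∨-zeroʳ (x ≈ᵇ y)

  ∈ᵇ≡false⇒∉ : ∀ {x L} → (x ∈ᵇ L) ≡ false → x ∉ L
  ∈ᵇ≡false⇒∉ x∈ᵇL≡false x∈L with () ← trans (sym (∈⇒∈ᵇ x∈L)) x∈ᵇL≡false

  ∉⇒∈ᵇ≡false : ∀ {x} L → x ∉ L → (x ∈ᵇ L) ≡ false
  ∉⇒∈ᵇ≡false {x} L x∉L with x ∈ᵇ L in x∈ᵇL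
  ... | true  = ⊥-elim (x∉L (∈ᵇ⇒∈ L x∈ᵇL))
  ... | false = refl

  module _ (Σ : (X → ℤ) → ℤ)
    (Σ-cong : ∀ {F G : X → ℤ} → (∀ x → F x ≡ G x) → Σ F ≡ Σ G)
    (Σ-+ : ∀ (F G : X → ℤ) → Σ (λ x → F x + G x) ≡ Σ F + Σ G)
    (Σ-0 : Σ (λ _ → 0ℤ) ≡ 0ℤ)
    (Σ-point : ∀ y → Σ (λ x → 𝟙 (x ≈ᵇ y)) ≡ 1ℤ) where

    Σ-𝟙∈ᵇ : ∀ L → Unique L → Σ (λ x → 𝟙 (x ∈ᵇ L)) ≡ + length L
    Σ-𝟙∈ᵇ []      []               = Σ-0
    Σ-𝟙∈ᵇ (y ∷ L) (y∉L ∷ L-unique) =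
      trans (Σ-cong split) (trans (Σ-+ (λ x → 𝟙 (x ≈ᵇ y)) (λ x → 𝟙 (x ∈ᵇ L)))
                                  (cong₂ _+_ (Σ-point y) (Σ-𝟙∈ᵇ L L-unique)))
      where
      y∈ᵇL≡false : (y ∈ᵇ L) ≡ false
      y∈ᵇL≡false = ∉⇒∈ᵇ≡false L (All¬⇒¬Any y∉L)
      split : ∀ x → 𝟙 ((x ≈ᵇ y) ∨ (x ∈ᵇ L)) ≡ 𝟙 (x ≈ᵇ y) + 𝟙 (x ∈ᵇ L)
      split x with x ≈ᵇ y in x≈y
      ... | true rewrite ≈ᵇ⇒≡ x≈y | y∈ᵇL≡false = refl
      ... | false = sym (ℤₚ.+-identityˡ _)

∑₂ : (Subset n × Subset n → ℤ) → ℤ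
∑₂ F = ∑ (λ h → ∑ (λ x → F (h , x)))

infix 4 _==₂_
_==₂_ : Subset n × Subset n → Subset n × Subset n → Bool
(h , x) ==₂ (h′ , x′) = (h == h′) ∧ (x == x′)

==₂⇒≡ : ∀ {p q : Subset n × Subset n} → (p ==₂ q) ≡ true → p ≡ q
==₂⇒≡ {p = h , x} {h′ , x′} p==q with h == h′ in h==h′
... | true = cong₂ _,_ (==⇒≡ h==h′) (==⇒≡ p==q)

==₂-refl : ∀ (p : Subset n × Subset n) → (p ==₂ p) ≡ true
==₂-refl (h , x) rewrite ==-refl h = ==-refl x

∑₂-point : ∀ (q : Subset n × Subset n) → ∑₂ (λ p → 𝟙 (p ==₂ q)) ≡ 1ℤ
∑₂-point (h′ , x′) = trans (∑-cong inner) (∑-𝟙== h′)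
  where
  inner : ∀ h → ∑ (λ x → 𝟙 ((h == h′) ∧ (x == x′))) ≡ 𝟙 (h == h′)
  inner h = begin
    ∑ (λ x → 𝟙 ((h == h′) ∧ (x == x′)))   ≡⟨ ∑-cong (λ x → 𝟙-∧ (h == h′) (x == x′)) ⟩
    ∑ (λ x → 𝟙 (h == h′) * 𝟙 (x == x′))   ≡⟨ ∑-*ˡ (𝟙 (h == h′)) (λ x → 𝟙 (x == x′)) ⟩
    𝟙 (h == h′) * ∑ (λ x → 𝟙 (x == x′))   ≡⟨ cong (𝟙 (h == h′) *_) (∑-𝟙== x′) ⟩
    𝟙 (h == h′) * 1ℤ                      ≡⟨ ℤₚ.*-identityʳ _ ⟩
    𝟙 (h == h′)                           ∎
    where open ≡-Reasoning

open module SubsetMembership {n} = BoolMembership (_==_ {n}) ==⇒≡ ==-refl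
  using (_∈ᵇ_; ∈ᵇ⇒∈; ∈⇒∈ᵇ; ∈ᵇ≡false⇒∉)

open module PairMembership {n} = BoolMembership (_==₂_ {n}) ==₂⇒≡ ==₂-refl
  using () renaming (_∈ᵇ_ to _∈ᵇ₂_; ∈⇒∈ᵇ to ∈⇒∈ᵇ₂)

∑-𝟙∈ᵇ : ∀ (L : List (Subset n)) → Unique L → ∑ (λ x → 𝟙 (x ∈ᵇ L)) ≡ + length L
∑-𝟙∈ᵇ {n} = SubsetMembership.Σ-𝟙∈ᵇ ∑ ∑-cong ∑-+ (∑-≡0 {n} (λ _ → refl)) ∑-𝟙==

∑₂-𝟙∈ᵇ : ∀ (L : List (Subset n × Subset n)) → Unique L → ∑₂ (λ p → 𝟙 (p ∈ᵇ₂ L)) ≡ + length L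
∑₂-𝟙∈ᵇ {n} = PairMembership.Σ-𝟙∈ᵇ ∑₂ (λ F≡G → ∑-cong (λ h → ∑-cong (λ x → F≡G (h , x))))
  (λ F G → trans (∑-cong (λ h → ∑-+ (λ x → F (h , x)) (λ x → G (h , x))))
                 (∑-+ (λ h → ∑ (λ x → F (h , x))) (λ h → ∑ (λ x → G (h , x)))))
  (∑-≡0 {n} (λ _ → ∑-≡0 {n} (λ _ → refl))) ∑₂-point

vertices : List (Subset n × Subset n) → List (Subset n)
vertices []            = []
vertices ((u , v) ∷ M) = u ∷ v ∷ vertices M

InVM⇒∈vertices : ∀ {M : List (Subset n × Subset n)} {v} → InVM M v → v ∈ vertices M
InVM⇒∈vertices (_ , here refl , inj₁ refl)  = here refl
InVM⇒∈vertices (_ , here refl , inj₂ refl)  = there (here refl)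
InVM⇒∈vertices {M = _ ∷ M} (e , there e∈M , v∈e) = there (there (InVM⇒∈vertices {M = M} (e , e∈M , v∈e)))

∈vertices⇒InVM : ∀ {M : List (Subset n × Subset n)} {v} → v ∈ vertices M → InVM M v
∈vertices⇒InVM {M = e ∷ M} (here refl)         = e , here refl , inj₁ refl
∈vertices⇒InVM {M = e ∷ M} (there (here refl)) = e , here refl , inj₂ refl
∈vertices⇒InVM {M = e ∷ M} (there (there v∈)) =
  Product.map id (Product.map there id) (∈vertices⇒InVM {M = M} v∈)

Endpoint : (M : List (Subset n × Subset n)) → Fin (length M) → Subset n → Set
Endpoint M i v = v ≡ proj₁ (List.lookup M i) ⊎ v ≡ proj₂ (List.lookup M i)

InVM⇒Endpoint : ∀ {M : List (Subset n × Subset n)} {v} → InVM M v → ∃ λ i → Endpoint M i v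
InVM⇒Endpoint (e , e∈M , inj₁ v≡) = index e∈M , inj₁ (trans v≡ (cong proj₁ (lookup-index e∈M)))
InVM⇒Endpoint (e , e∈M , inj₂ v≡) = index e∈M , inj₂ (trans v≡ (cong proj₂ (lookup-index e∈M)))

Endpoint-other : ∀ {M : List (Subset n × Subset n)} {i x h h′} →
  Endpoint M i x → Endpoint M i h → Endpoint M i h′ → h ≢ x → h′ ≢ x → h ≡ h′
Endpoint-other (inj₁ x≡) (inj₁ h≡) _         h≢x _    = ⊥-elim (h≢x (trans h≡ (sym x≡)))
Endpoint-other (inj₂ x≡) (inj₂ h≡) _         h≢x _    = ⊥-elim (h≢x (trans h≡ (sym x≡)))
Endpoint-other (inj₁ x≡) (inj₂ _)  (inj₁ h′≡) _  h′≢x = ⊥-elim (h′≢x (trans h′≡ (sym x≡)))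
Endpoint-other (inj₂ x≡) (inj₁ _)  (inj₂ h′≡) _  h′≢x = ⊥-elim (h′≢x (trans h′≡ (sym x≡)))
Endpoint-other (inj₁ _)  (inj₂ h≡) (inj₂ h′≡) _  _    = trans h≡ (sym h′≡)
Endpoint-other (inj₂ _)  (inj₁ h≡) (inj₁ h′≡) _  _    = trans h≡ (sym h′≡)

induced-Adj⇒same-edge : ∀ {d} {M : List (Subset n × Subset n)} → IsInducedMatching n d M →
  ∀ {i j x v} → Endpoint M i x → Endpoint M j v → Adj n d x v → i ≡ j
induced-Adj⇒same-edge (_ , induced) {i} {j} x∈i v∈j x~v with i Fin.≟ j
... | yes i≡j = i≡j
... | no  i≢j with proj₂ (induced i j i≢j) | x∈i | v∈j
...   | ¬x~u , _ , _ , _ | inj₁ refl | inj₁ refl = ⊥-elim (¬x~u x~v)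
...   | _ , ¬x~v , _ , _ | inj₁ refl | inj₂ refl = ⊥-elim (¬x~v x~v)
...   | _ , _ , ¬y~u , _ | inj₂ refl | inj₁ refl = ⊥-elim (¬y~u x~v)
...   | _ , _ , _ , ¬y~v | inj₂ refl | inj₂ refl = ⊥-elim (¬y~v x~v)

⋖⇒≢ : ∀ {h x : Subset n} → (h ⋖ x) ≡ true → h ≢ x
⋖⇒≢ {h = h} h⋖x refl = ℕₚ.1+n≢n (sym (⋖⇒∣∣ {h = h} h⋖x))

⋖⇒Adj : ∀ {h x : Subset n} → (h ⋖ x) ≡ true → ∣ x ∣ ≡ suc k → Adj n (suc k) h x
⋖⇒Adj {h = h} h⋖x ∣x∣≡d =
  inj₂ (ℕₚ.suc-injective (trans (sym (⋖⇒∣∣ {h = h} h⋖x)) ∣x∣≡d)) , inj₁ ∣x∣≡d , inj₁ (⋖⇒⊂ {h = h} h⋖x)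

Adj-sym : ∀ {d} {u v : Subset n} → Adj n d u v → Adj n d v u
Adj-sym (u-vertex , v-vertex , u⊂v⊎v⊂u) = v-vertex , u-vertex , Sum.swap u⊂v⊎v⊂u

cover-in-VM-unique : ∀ {A : List (Subset n)} {M} → IsInducedMatching n (suc k) M →
  (∀ x → x ∈ A → ¬ InVM M x → ∀ v → InVM M v → ¬ Adj n (suc k) x v) →
  ∀ {x h h′} → x ∈ A → ∣ x ∣ ≡ suc k → (h ⋖ x) ≡ true → (h′ ⋖ x) ≡ true → InVM M h → InVM M h′ → h ≡ h′
cover-in-VM-unique {M = M} M-induced isolated {x} {h} {h′} x∈A ∣x∣≡d h⋖x h′⋖x h∈V h′∈V
  with x ∈ᵇ vertices M in x∈ᵇV
... | false =
  ⊥-elim (isolated x x∈A (∈ᵇ≡false⇒∉ x∈ᵇV ∘ InVM⇒∈vertices) h h∈V (Adj-sym (⋖⇒Adj {h = h} h⋖x ∣x∣≡d)))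
... | true with InVM⇒Endpoint {M = M} (∈vertices⇒InVM {M = M} (∈ᵇ⇒∈ (vertices M) x∈ᵇV))
               | InVM⇒Endpoint {M = M} h∈V | InVM⇒Endpoint {M = M} h′∈V
...   | i , x∈i | j , h∈j | j′ , h′∈j′ =
  Endpoint-other {M = M} {i} {x} {h} {h′} x∈i
    (subst (λ l → Endpoint M l h) (sym i≡j) h∈j) (subst (λ l → Endpoint M l h′) (sym i≡j′) h′∈j′)
    (⋖⇒≢ {h = h} h⋖x) (⋖⇒≢ {h = h′} h′⋖x)
  where
  i≡j : i ≡ j
  i≡j = induced-Adj⇒same-edge {M = M} M-induced {i} {j} {x} {h} x∈i h∈j
          (Adj-sym (⋖⇒Adj {h = h} h⋖x ∣x∣≡d))
  i≡j′ : i ≡ j′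
  i≡j′ = induced-Adj⇒same-edge {M = M} M-induced {i} {j′} {x} {h′} x∈i h′∈j′
           (Adj-sym (⋖⇒Adj {h = h′} h′⋖x ∣x∣≡d))

*-nonneg : ∀ {u v} → 0ℤ ≤ u → 0ℤ ≤ v → 0ℤ ≤ u * v
*-nonneg {u} {v} 0≤u 0≤v = subst (_≤ u * v) (ℤₚ.*-zeroʳ u) (ℤₚ.*-monoˡ-≤-nonNeg u {{ℤ.nonNegative 0≤u}} 0≤v)

0≤z*[z-1] : ∀ z → 0ℤ ≤ z * (z - 1ℤ)
0≤z*[z-1] (+ zero)  = ℤₚ.≤-refl
0≤z*[z-1] (+ suc t) = subst (0ℤ ≤_) (ℤₚ.pos-* (suc t) t) (+≤+ ℕ.z≤n)
0≤z*[z-1] -[1+ _ ]  = +≤+ ℕ.z≤n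

private
  ν≡ : ∀ T O ν → T + O ≡ 1ℤ + ν → T + O - 1ℤ ≡ ν
  ν≡ T O ν eq = trans (cong (_- 1ℤ) eq) (solve ν)
    where solve : ∀ ν → 1ℤ + ν - 1ℤ ≡ ν
          solve = solve-∀

-- A vertex h below A carries T edges into A and O edges out of it, with T + O = 1 + ν;
-- it is charged to H (weight O) if unmatched and to V(M) (weight T) if matched.
vertex-charge-bound : ∀ (matched : Bool) (T O ν : ℤ) → 0ℤ ≤ T → 0ℤ ≤ O → 0ℤ ≤ ν →
  (T ≢ 0ℤ → T + O ≡ 1ℤ + ν) →
  T * O ≤ ν * (𝟙 (not matched ∧ (1ℤ ≤ᵇ T)) * O) + ν * (𝟙 matched * T)
vertex-charge-bound b (+ zero) O ν _ 0≤O 0≤ν _ =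
  ℤₚ.+-mono-≤ (*-nonneg 0≤ν (*-nonneg (𝟙-nonneg (not b ∧ false)) 0≤O))
              (*-nonneg 0≤ν (*-nonneg (𝟙-nonneg b) ℤₚ.≤-refl))
vertex-charge-bound _ -[1+ _ ] _ _ () _ _ _
vertex-charge-bound true T@(+ suc _) O ν _ _ _ T+O≡1+ν =
  subst (λ ν → T * O ≤ ν * (0ℤ * O) + ν * (1ℤ * T)) (ν≡ T O ν (T+O≡1+ν (λ ())))
        (ℤₚ.0≤i-j⇒j≤i (subst (0ℤ ≤_) (regroup T O) (0≤z*[z-1] T)))
  where
  regroup : ∀ T O → T * (T - 1ℤ) ≡ ((T + O - 1ℤ) * (0ℤ * O) + (T + O - 1ℤ) * (1ℤ * T)) - T * O
  regroup = solve-∀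
vertex-charge-bound false T@(+ suc _) O ν _ _ _ T+O≡1+ν =
  subst (λ ν → T * O ≤ ν * (1ℤ * O) + ν * (0ℤ * T)) (ν≡ T O ν (T+O≡1+ν (λ ())))
        (ℤₚ.0≤i-j⇒j≤i (subst (0ℤ ≤_) (regroup T O) (0≤z*[z-1] O)))
  where
  regroup : ∀ T O → O * (O - 1ℤ) ≡ ((T + O - 1ℤ) * (1ℤ * O) + (T + O - 1ℤ) * (0ℤ * T)) - T * O
  regroup = solve-∀

-- Multiplying the edge bound by N, adding the variance bound and using n c = d N eliminates Q and N.
combine-bounds : ∀ (K ν N c a e Q : ℤ) → 0ℤ ℤ.< N → 0ℤ ≤ c →
  (1ℤ + K + ν) * c ≡ (1ℤ + K) * N →
  (1ℤ + ν) * ((1ℤ + K) * a) - Q ≤ ν * e + ν * a →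
  N * Q ≤ (K * ν) * (N * a - a * a) + ((1ℤ + ν) * (1ℤ + K)) * (a * a) →
  (1ℤ + K) * (a * c) ≤ ν * (e * c) + (1ℤ + K) * (a * a)
combine-bounds K ν N c a e Q 0<N 0≤c nc≡dN edge variance =
  ℤₚ.0≤i-j⇒j≤i (ℤₚ.*-cancelˡ-≤-pos 0ℤ _ N {{ℤ.positive 0<N}}
    (subst₂ _≤_ (sym (ℤₚ.*-zeroʳ N)) (sym N*gap≡) (*-nonneg 0≤c 0≤N*D₁+D₂)))
  where
  D₁ D₂ : ℤ
  D₁ = (ν * e + ν * a) - ((1ℤ + ν) * ((1ℤ + K) * a) - Q)
  D₂ = ((K * ν) * (N * a - a * a) + ((1ℤ + ν) * (1ℤ + K)) * (a * a)) - N * Q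
  0≤N*D₁+D₂ : 0ℤ ≤ N * D₁ + D₂
  0≤N*D₁+D₂ = ℤₚ.+-mono-≤ (*-nonneg (ℤₚ.<⇒≤ 0<N) (ℤₚ.i≤j⇒0≤j-i edge)) (ℤₚ.i≤j⇒0≤j-i variance)
  identity : ∀ K ν N c a e Q →
    N * ((ν * (e * c) + (1ℤ + K) * (a * a)) - (1ℤ + K) * (a * c))
    ≡ c * (N * ((ν * e + ν * a) - ((1ℤ + ν) * ((1ℤ + K) * a) - Q))
           + (((K * ν) * (N * a - a * a) + ((1ℤ + ν) * (1ℤ + K)) * (a * a)) - N * Q))
      - (a * a) * ((1ℤ + K + ν) * c - (1ℤ + K) * N)
  identity = solve-∀
  N*gap≡ : N * ((ν * (e * c) + (1ℤ + K) * (a * a)) - (1ℤ + K) * (a * c)) ≡ c * (N * D₁ + D₂)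
  N*gap≡ = begin
    N * ((ν * (e * c) + (1ℤ + K) * (a * a)) - (1ℤ + K) * (a * c))
      ≡⟨ identity K ν N c a e Q ⟩
    R - a * a * ((1ℤ + K + ν) * c - (1ℤ + K) * N)
      ≡⟨ cong (λ z → R - a * a * (z - (1ℤ + K) * N)) nc≡dN ⟩
    R - a * a * ((1ℤ + K) * N - (1ℤ + K) * N)
      ≡⟨ cong (λ z → R - a * a * z) (ℤₚ.+-inverseʳ ((1ℤ + K) * N)) ⟩
    R - a * a * 0ℤ
      ≡⟨ solve R (a * a) ⟩
    R
    ∎
    where
    open ≡-Reasoning
    R : ℤ
    R = c * (N * D₁ + D₂)
    solve : ∀ X Y → X - Y * 0ℤ ≡ X
    solve = solve-∀

module EdgeCount {n k : ℕ} (k<n : suc k ℕ.≤ n)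
  {A : List (Subset n)} (A-level : All (λ a → ∣ a ∣ ≡ suc k) A)
  {M : List (Subset n × Subset n)} (M-induced : IsInducedMatching n (suc k) M)
  (isolated : ∀ x → x ∈ A → ¬ InVM M x → ∀ v → InVM M v → ¬ Adj n (suc k) x v)
  {E : List (Subset n × Subset n)} (E-edges : ∀ p → (p ∈ E) ⇔ EdgeHOut n (suc k) A M p) where

  𝟙A : Fun n
  𝟙A x = 𝟙 (x ∈ᵇ A)

  outside : Subset n → Bool
  outside x = (∣ x ∣ ≡ᵇ suc k) ∧ not (x ∈ᵇ A)

  out : Fun n
  out = down (𝟙 ∘ outside)

  matched : Subset n → Bool
  matched h = h ∈ᵇ vertices M

  touched : Subset n → Bool
  touched h = not (matched h) ∧ (1ℤ ≤ᵇ down 𝟙A h)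

  ν : ℤ
  ν = + (n ℕ.∸ suc k)

  n-k≡1+ν : + n - + k ≡ 1ℤ + ν
  n-k≡1+ν = trans (+n-+d≡+[n∸d] (ℕₚ.<⇒≤ k<n)) (cong +_ (ℕₚ.+-∸-assoc 1 k<n))

  ∈ᵇA⇒∣∣ : ∀ {x} → (x ∈ᵇ A) ≡ true → ∣ x ∣ ≡ suc k
  ∈ᵇA⇒∣∣ x∈ᵇA = All.lookup A-level (∈ᵇ⇒∈ A x∈ᵇA)

  𝟙A-onLevel : OnLevel (suc k) 𝟙A
  𝟙A-onLevel x ∣x∣≢d with x ∈ᵇ A in x∈ᵇA
  ... | true  = ⊥-elim (∣x∣≢d (∈ᵇA⇒∣∣ x∈ᵇA))
  ... | false = refl

  ‖𝟙A‖²≡∑𝟙A : ‖ 𝟙A ‖² ≡ ∑ 𝟙A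
  ‖𝟙A‖²≡∑𝟙A = ∑-cong (λ x → 𝟙-idem (x ∈ᵇ A))
    where 𝟙-idem : ∀ b → 𝟙 b * 𝟙 b ≡ 𝟙 b
          𝟙-idem true  = refl
          𝟙-idem false = refl

  𝟙A+outside≡level : ∀ x → 𝟙A x + 𝟙 (outside x) ≡ level (suc k) x
  𝟙A+outside≡level x with x ∈ᵇ A in x∈ᵇA
  ... | true  = trans (cong (λ b → 1ℤ + 𝟙 b) (Boolₚ.∧-zeroʳ (∣ x ∣ ≡ᵇ suc k)))
                      (sym (trans (cong (λ j → 𝟙 (j ≡ᵇ suc k)) (∈ᵇA⇒∣∣ x∈ᵇA)) (𝟙[d≡ᵇd]≡1 (suc k))))
  ... | false = trans (ℤₚ.+-identityˡ _) (cong 𝟙 (Boolₚ.∧-identityʳ _))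

  down-𝟙A≢0⇒∣∣ : ∀ {h} → down 𝟙A h ≢ 0ℤ → ∣ h ∣ ≡ k
  down-𝟙A≢0⇒∣∣ {h} down𝟙A≢0 with ∣ h ∣ ℕ.≟ k
  ... | yes ∣h∣≡k = ∣h∣≡k
  ... | no  ∣h∣≢k = ⊥-elim (down𝟙A≢0 (down-onLevel 𝟙A-onLevel h ∣h∣≢k))

  down-𝟙A+out≡down-level : ∀ h → down 𝟙A h + out h ≡ down (level (suc k)) h
  down-𝟙A+out≡down-level h = trans (sym (down-+ 𝟙A (𝟙 ∘ outside) h)) (down-cong 𝟙A+outside≡level h)

  down-𝟙A+out : ∀ h → down 𝟙A h ≢ 0ℤ → down 𝟙A h + out h ≡ 1ℤ + ν
  down-𝟙A+out h down𝟙A≢0 = begin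
    down 𝟙A h + out h                         ≡⟨ down-𝟙A+out≡down-level h ⟩
    down (level (suc k)) h                    ≡⟨ down-radial (λ j → 𝟙 (j ≡ᵇ suc k)) h ⟩
    (+ n - + ∣ h ∣) * 𝟙 (∣ h ∣ ≡ᵇ k)          ≡⟨ cong (λ j → (+ n - + j) * 𝟙 (j ≡ᵇ k)) (down-𝟙A≢0⇒∣∣ down𝟙A≢0) ⟩
    (+ n - + k) * 𝟙 (k ≡ᵇ k)                  ≡⟨ cong ((+ n - + k) *_) (𝟙[d≡ᵇd]≡1 k) ⟩
    (+ n - + k) * 1ℤ                          ≡⟨ ℤₚ.*-identityʳ _ ⟩
    + n - + k                                 ≡⟨ n-k≡1+ν ⟩
    1ℤ + ν                                    ∎
    where open ≡-Reasoning

  pointwise-bound : ∀ h → down 𝟙A h * out h ≤ ν * (𝟙 (touched h) * out h) + ν * (𝟙 (matched h) * down 𝟙A h)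
  pointwise-bound h = vertex-charge-bound (matched h) (down 𝟙A h) (out h) ν
    (down-nonneg (λ x → 𝟙-nonneg (x ∈ᵇ A)) h) (down-nonneg (λ x → 𝟙-nonneg (outside x)) h) (+≤+ ℕ.z≤n)
    (down-𝟙A+out h)

  matched⇒InVM : ∀ {h} → matched h ≡ true → InVM M h
  matched⇒InVM {h} h∈ᵇV = ∈vertices⇒InVM {M = M} (∈ᵇ⇒∈ (vertices M) h∈ᵇV)

  touched-edge : ∀ {h x} → touched h ≡ true → (h ⋖ x) ≡ true → outside x ≡ true → EdgeHOut n (suc k) A M (h , x)
  touched-edge {h} {x} h-touched h⋖x x-outside =
    ((inj₂ (down-𝟙A≢0⇒∣∣ down≢0) , y , ∈ᵇ⇒∈ A y∈ᵇA , ⋖⇒Adj {h = h} h⋖y (∈ᵇA⇒∣∣ y∈ᵇA)) , h∉V) ,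
    ∣x∣≡d , ∈ᵇ≡false⇒∉ x∉ᵇA , ⋖⇒Adj {h = h} h⋖x ∣x∣≡d
    where
    h∉V : ¬ InVM M h
    h∉V = ∈ᵇ≡false⇒∉ (not≡true (Boolₚ.∧-conicalˡ _ _ h-touched)) ∘ InVM⇒∈vertices
    down≢0 : down 𝟙A h ≢ 0ℤ
    down≢0 = 1≤ᵇ⇒≢0 (Boolₚ.∧-conicalʳ _ _ h-touched)
    witness : ∃ λ y → 𝟙 (h ⋖ y) * 𝟙A y ≢ 0ℤ
    witness = ∑-witness (λ y → 𝟙 (h ⋖ y) * 𝟙A y) (down≢0 ∘ trans (down-as-sum 𝟙A h))
    y : Subset n
    y = proj₁ witness
    h⋖y : (h ⋖ y) ≡ true
    h⋖y = proj₁ (𝟙*≢0 (h ⋖ y) (𝟙A y) (proj₂ witness))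
    y∈ᵇA : (y ∈ᵇ A) ≡ true
    y∈ᵇA = 𝟙≢0 (proj₂ (𝟙*≢0 (h ⋖ y) (𝟙A y) (proj₂ witness)))
    ∣x∣≡d : ∣ x ∣ ≡ suc k
    ∣x∣≡d = ℕₚ.≡ᵇ⇒≡ ∣ x ∣ (suc k) (Equivalence.from Boolₚ.T-≡ (Boolₚ.∧-conicalˡ _ _ x-outside))
    x∉ᵇA : (x ∈ᵇ A) ≡ false
    x∉ᵇA = not≡true (Boolₚ.∧-conicalʳ _ _ x-outside)

  ∑touched*out≤|E| : ∑ (λ h → 𝟙 (touched h) * out h) ≤ ∑₂ (λ p → 𝟙 (p ∈ᵇ₂ E))
  ∑touched*out≤|E| = begin
    ∑ (λ h → 𝟙 (touched h) * out h)
      ≡⟨ ∑-cong (λ h → trans (cong (𝟙 (touched h) *_) (down-as-sum (𝟙 ∘ outside) h))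
                             (sym (∑-*ˡ (𝟙 (touched h)) (λ x → 𝟙 (h ⋖ x) * 𝟙 (outside x))))) ⟩
    ∑ (λ h → ∑ (λ x → 𝟙 (touched h) * (𝟙 (h ⋖ x) * 𝟙 (outside x))))
      ≤⟨ ∑-mono-≤ (λ h → ∑-mono-≤ (λ x → edge-bound h x)) ⟩
    ∑₂ (λ p → 𝟙 (p ∈ᵇ₂ E))
    ∎
    where
    open ℤₚ.≤-Reasoning
    edge-bound : ∀ h x → 𝟙 (touched h) * (𝟙 (h ⋖ x) * 𝟙 (outside x)) ≤ 𝟙 ((h , x) ∈ᵇ₂ E)
    edge-bound h x =
      subst (_≤ 𝟙 ((h , x) ∈ᵇ₂ E))
            (trans (𝟙-∧ (touched h) _) (cong (𝟙 (touched h) *_) (𝟙-∧ (h ⋖ x) (outside x))))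
            (𝟙-mono (λ all-true → ∈⇒∈ᵇ₂ (Equivalence.from (E-edges (h , x))
              (touched-edge (Boolₚ.∧-conicalˡ (touched h) _ all-true)
                            (Boolₚ.∧-conicalˡ (h ⋖ x) (outside x) (Boolₚ.∧-conicalʳ (touched h) _ all-true))
                            (Boolₚ.∧-conicalʳ (h ⋖ x) (outside x) (Boolₚ.∧-conicalʳ (touched h) _ all-true))))))

  ∑matched*down≤∑𝟙A : ∑ (λ h → 𝟙 (matched h) * down 𝟙A h) ≤ ∑ 𝟙A
  ∑matched*down≤∑𝟙A = begin
    ∑ (λ h → 𝟙 (matched h) * down 𝟙A h)   ≡⟨ ∑-cong (λ h → ℤₚ.*-comm (𝟙 (matched h)) (down 𝟙A h)) ⟩
    ⟨ down 𝟙A , 𝟙 ∘ matched ⟩             ≡⟨ down-up-adjoint 𝟙A (𝟙 ∘ matched) ⟩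
    ⟨ 𝟙A , up (𝟙 ∘ matched) ⟩             ≤⟨ ∑-mono-≤ pointwise ⟩
    ∑ 𝟙A                                  ∎
    where
    open ℤₚ.≤-Reasoning
    pointwise : ∀ x → 𝟙A x * up (𝟙 ∘ matched) x ≤ 𝟙A x
    pointwise x with x ∈ᵇ A in x∈ᵇA
    ... | false = ℤₚ.≤-refl
    ... | true  = ℤₚ.≤-trans (ℤₚ.≤-reflexive (ℤₚ.*-identityˡ _))
                    (subst (_≤ 1ℤ) (sym (trans (up-as-sum (𝟙 ∘ matched) x)
                                               (∑-cong (λ h → sym (𝟙-∧ (h ⋖ x) (matched h))))))
                      (∑-𝟙-≤1 (λ h → (h ⋖ x) ∧ matched h) unique))
      where
      unique : ∀ h h′ → ((h ⋖ x) ∧ matched h) ≡ true → ((h′ ⋖ x) ∧ matched h′) ≡ true → h ≡ h′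
      unique h h′ p p′ = cover-in-VM-unique {M = M} M-induced isolated (∈ᵇ⇒∈ A x∈ᵇA) (∈ᵇA⇒∣∣ x∈ᵇA)
        (Boolₚ.∧-conicalˡ _ _ p) (Boolₚ.∧-conicalˡ _ _ p′)
        (matched⇒InVM (Boolₚ.∧-conicalʳ _ _ p)) (matched⇒InVM (Boolₚ.∧-conicalʳ _ _ p′))

  ∑down*out≡ : ∑ (λ h → down 𝟙A h * out h) ≡ (1ℤ + ν) * (+ suc k * ∑ 𝟙A) - ‖ down 𝟙A ‖²
  ∑down*out≡ = begin
    ∑ (λ h → down 𝟙A h * out h)
      ≡⟨ ∑-cong (λ h → trans (cong (down 𝟙A h *_) (out≡ h)) (split (down 𝟙A h) (down (level (suc k)) h))) ⟩
    ∑ (λ h → 1ℤ * (down 𝟙A h * down (level (suc k)) h) + -1ℤ * (down 𝟙A h * down 𝟙A h))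
      ≡⟨ ∑-linear 1ℤ -1ℤ (λ h → down 𝟙A h * down (level (suc k)) h) (λ h → down 𝟙A h * down 𝟙A h) ⟩
    1ℤ * ⟨ down 𝟙A , down (level (suc k)) ⟩ + -1ℤ * ‖ down 𝟙A ‖²
      ≡⟨ cong (λ z → 1ℤ * z + -1ℤ * ‖ down 𝟙A ‖²)
              (trans (⟨down,down-level⟩ 𝟙A-onLevel) (cong (_* (+ suc k * ∑ 𝟙A)) n-k≡1+ν)) ⟩
    1ℤ * ((1ℤ + ν) * (+ suc k * ∑ 𝟙A)) + -1ℤ * ‖ down 𝟙A ‖²
      ≡⟨ tidy ((1ℤ + ν) * (+ suc k * ∑ 𝟙A)) ‖ down 𝟙A ‖² ⟩
    (1ℤ + ν) * (+ suc k * ∑ 𝟙A) - ‖ down 𝟙A ‖²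
    ∎
    where
    open ≡-Reasoning
    out≡ : ∀ h → out h ≡ down (level (suc k)) h - down 𝟙A h
    out≡ h = trans (solve (down 𝟙A h) (out h)) (cong (_- down 𝟙A h) (down-𝟙A+out≡down-level h))
      where solve : ∀ T O → O ≡ (T + O) - T
            solve = solve-∀
    split : ∀ T L → T * (L - T) ≡ 1ℤ * (T * L) + -1ℤ * (T * T)
    split = solve-∀
    tidy : ∀ X Q → 1ℤ * X + -1ℤ * Q ≡ X - Q
    tidy = solve-∀

  edge-count-bound :
    (1ℤ + ν) * (+ suc k * ∑ 𝟙A) - ‖ down 𝟙A ‖² ≤ ν * ∑₂ (λ p → 𝟙 (p ∈ᵇ₂ E)) + ν * ∑ 𝟙A
  edge-count-bound = begin
    (1ℤ + ν) * (+ suc k * ∑ 𝟙A) - ‖ down 𝟙A ‖²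
      ≡⟨ ∑down*out≡ ⟨
    ∑ (λ h → down 𝟙A h * out h)
      ≤⟨ ∑-mono-≤ pointwise-bound ⟩
    ∑ (λ h → ν * (𝟙 (touched h) * out h) + ν * (𝟙 (matched h) * down 𝟙A h))
      ≡⟨ ∑-linear ν ν (λ h → 𝟙 (touched h) * out h) (λ h → 𝟙 (matched h) * down 𝟙A h) ⟩
    ν * ∑ (λ h → 𝟙 (touched h) * out h) + ν * ∑ (λ h → 𝟙 (matched h) * down 𝟙A h)
      ≤⟨ ℤₚ.+-mono-≤ (ℤₚ.*-monoˡ-≤-nonNeg ν ∑touched*out≤|E|)
                     (ℤₚ.*-monoˡ-≤-nonNeg ν ∑matched*down≤∑𝟙A) ⟩
    ν * ∑₂ (λ p → 𝟙 (p ∈ᵇ₂ E)) + ν * ∑ 𝟙A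
    ∎
    where open ℤₚ.≤-Reasoning

  down-𝟙A-variance : let N = + (n C suc k); a = ∑ 𝟙A in
    N * ‖ down 𝟙A ‖² ≤ (+ k * ν) * (N * a - a * a) + ((1ℤ + ν) * + suc k) * (a * a)
  down-𝟙A-variance =
    subst₂ (λ u v → N * ‖ down 𝟙A ‖² ≤ (+ k * u) * (N * a - a * a) + (v * + suc k) * (a * a))
           (+n-+d≡+[n∸d] k<n) n-k≡1+ν
           (subst (λ F → N * ‖ down 𝟙A ‖² ≤ (+ k * (+ n - + suc k)) * (N * F - a * a)
                                              + ((+ n - + k) * + suc k) * (a * a))
                  ‖𝟙A‖²≡∑𝟙A
                  (level-variance-bound k k<n 𝟙A-onLevel))
    where
    N a : ℤ
    N = + (n C suc k)
    a = ∑ 𝟙A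

pos-*-* : ∀ x y z → + x * (+ y * + z) ≡ + (x ℕ.* (y ℕ.* z))
pos-*-* x y z = trans (cong (+ x *_) (sym (ℤₚ.pos-* y z))) (sym (ℤₚ.pos-* x (y ℕ.* z)))

drop-+-bound : ∀ d a c e ν → + d * (+ a * + c) ≤ + ν * (+ e * + c) + + d * (+ a * + a) →
  d ℕ.* (a ℕ.* c) ℕ.≤ ν ℕ.* (e ℕ.* c) ℕ.+ d ℕ.* (a ℕ.^ 2)
drop-+-bound d a c e ν bound = ℤₚ.drop‿+≤+ (subst₂ _≤_ (pos-*-* d a c) rhs≡ bound)
  where
  rhs≡ : + ν * (+ e * + c) + + d * (+ a * + a) ≡ + (ν ℕ.* (e ℕ.* c) ℕ.+ d ℕ.* (a ℕ.^ 2))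
  rhs≡ = trans (cong₂ _+_ (pos-*-* ν e c)
                          (trans (pos-*-* d a a) (cong (λ z → + (d ℕ.* (a ℕ.* z))) (sym (ℕₚ.*-identityʳ a)))))
               (sym (ℤₚ.pos-+ (ν ℕ.* (e ℕ.* c)) (d ℕ.* (a ℕ.^ 2))))

n*C[m,k]≡d*C[n,d] : ∀ m k → k ℕ.≤ m → (1ℤ + + k + + (m ℕ.∸ k)) * + (m C k) ≡ (1ℤ + + k) * + (suc m C suc k)
n*C[m,k]≡d*C[n,d] m k k≤m = begin
  (1ℤ + + k + + (m ℕ.∸ k)) * + (m C k)    ≡⟨ cong (λ z → + suc z * + (m C k)) (ℕₚ.m+[n∸m]≡n k≤m) ⟩
  + suc m * + (m C k)                     ≡⟨ ℤₚ.pos-* (suc m) (m C k) ⟨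
  + (suc m ℕ.* (m C k))                   ≡⟨ cong +_ ([1+k]*[1+n]C[1+k]≡[1+n]*nCk m k) ⟨
  + (suc k ℕ.* (suc m C suc k))           ≡⟨ ℤₚ.pos-* (suc k) (suc m C suc k) ⟩
  (1ℤ + + k) * + (suc m C suc k)          ∎
  where open ≡-Reasoning

lemma2p15 : (n d : ℕ) → 1 ℕ.≤ d → d ℕ.< n →
    (A : List (Subset n)) → Unique A → All (λ a → ∣ a ∣ ≡ d) A →
    (M : List (Subset n × Subset n)) → IsInducedMatching n d M →
    (∀ x → x ∈ A → ¬ InVM M x → ∀ v → InVM M v → ¬ Adj n d x v) →
    (E : List (Subset n × Subset n)) → Unique E →
    (∀ p → (p ∈ E) ⇔ EdgeHOut n d A M p) →
    d ℕ.* (length A ℕ.* ((n ℕ.∸ 1) C (d ℕ.∸ 1)))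
    ℕ.≤ (n ℕ.∸ d) ℕ.* (length E ℕ.* ((n ℕ.∸ 1) C (d ℕ.∸ 1))) ℕ.+ d ℕ.* (length A ℕ.^ 2)
lemma2p15 (suc m) (suc k) _ (ℕ.s≤s k<m) A A-unique A-level M M-induced isolated E E-unique E-edges =
  drop-+-bound (suc k) (length A) (m C k) (length E) (m ℕ.∸ k)
    (subst₂ (λ a e → + suc k * (a * + (m C k)) ≤ ν * (e * + (m C k)) + + suc k * (a * a))
            (∑-𝟙∈ᵇ A A-unique) (∑₂-𝟙∈ᵇ E E-unique)
            (combine-bounds (+ k) ν (+ (suc m C suc k)) (+ (m C k))
                            (∑ 𝟙A) (∑₂ (λ p → 𝟙 (p ∈ᵇ₂ E))) ‖ down 𝟙A ‖²
              (ℤ.+<+ (0<nCk k<1+m)) (+≤+ ℕ.z≤n) (n*C[m,k]≡d*C[n,d] m k (ℕₚ.<⇒≤ k<m))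
              edge-count-bound down-𝟙A-variance))
  where
  k<1+m : suc k ℕ.≤ suc m
  k<1+m = ℕₚ.m<n⇒m<1+n k<m
  open EdgeCount k<1+m A-level M-induced isolated E-edges
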